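{- Let $\alpha$ and $\beta$ be compositions of $n$. If $(T,S)\in C_{\alpha,\beta}$, then $\psi_{\alpha,\beta}(T,S)$ (as defined in the context) is well defined and belongs to $C_{\alpha,\beta}$.
   Context: A composition of $n$ is a finite sequence of positive integers summing to $n$. For a composition $\gamma=(\gamma_1,\dots,\gamma_\ell)$, its diagram has cells $(i,j)$, $1\le i\le\ell$, $1\le j\le\gamma_i$ (row $i$ from the top). An immaculate tableau of shape $\gamma$ is a filling by positive integers with rows weakly increasing left to right and first column strictly increasing top to bottom; its content counts entries of each value. For an integer sequence $a$, $\operatorname{fl}(a)$ deletes its zero entries. Permutations are in one-line notation, $s_i=(i,i+1)$, products compose right to left. Tunnel hook coverings (THCs), introduced by Allen and Mason; only these facts are needed: for a composition $\gamma=(\gamma_1,\dots,\gamma_\ell)$, each THC $T$ of shape $\gamma$ has a permutation $\operatorname{perm}(T)\in S_\ell$, and $T\mapsto\operatorname{perm}(T)$ is a bijection from THCs of shape $\gamma$ onto $S_\ell$; $\operatorname{sgn}(T)=\operatorname{sgn}(\operatorname{perm}(T))$; $\Delta_i(T)=\gamma_i+\sigma_i-i$ for $\sigma=\operatorname{perm}(T)$; the content of $T$ is $\operatorname{fl}(\Delta(T))$. $C_{\alpha,\beta}$ is the set of pairs $(T,S)$ with $T$ a THC of content $\alpha$, $S$ an immaculate tableau of content $\beta$, and $T,S$ of the same shape. The map $\psi_{\alpha,\beta}$: let $(T,S)\in C_{\alpha,\beta}$, $\sigma=\operatorname{perm}(T)$, common shape $\gamma=(\gamma_1,\dots,\gamma_\ell)$,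 and $M$ the maximum entry of $S$. (1) Let $k$ be the smallest nonnegative integer less than $\ell$ such that for all $i\in\{k+1,\dots,\ell\}$: (a) $\sigma_i=i$; (b) row $i$ of $S$ contains no entries other than $M-\ell+i$; (c) $M-\ell+i$ appears only in row $i$ of $S$. If no such $k$ exists, set $k=\ell$. (2) If $k=0$, set $\psi_{\alpha,\beta}(T,S)=(T,S)$. (3) Otherwise let $\mathcal R=\{\sigma_j: M-\ell+k \text{ appears in row } j \text{ of } S\}$ and choose $r$ with $\sigma_r$ minimal in $\mathcal R$. (4) If $\sigma_r=k$: delete the rightmost entry of row $r$ of $S$ and then insert a new row consisting of a single cell with entry $M-\ell+k$ between rows $k$ and $k+1$ (it becomes row $k+1$), obtaining $U$; regard $\sigma$ as an element of $S_{\ell+1}$ fixing $\ell+1$, and let $V$ be the THC of shape $\operatorname{sh}(U)$ with $\operatorname{perm}(V)=s_k\sigma$. (5) If $\sigma_r\neq k$: delete the rightmost entry of row $r$ of $S$, set $q=\sigma_r$, and append a cell with entry $M-\ell+k$ to the end of row $p=\sigma^{ -1}(q+1)$, obtaining $U$; if row $r$ of $U$ is now empty, delete it, shifting rows $r+1,\dots,\ell$ up. Let $V$ be the THC of shape $\operatorname{sh}(U)$ with $\operatorname{perm}(V)=s_q\sigma$. Set $\psi_{\alpha,\beta}(T,S)=(V,U)$. -}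

module Defs where

open import Data.Nat using (ℕ; zero; suc; _+_; _∸_; _⊔_; _≤_; _<_; _≤ᵇ_)
open import Data.Nat.Properties using (_≟_)
open import Data.Bool using (Bool; true; false; _∧_; _∨_; not; if_then_else_)
open import Data.List using (List; []; _∷_; [_]; _++_; map; length; concat; upTo; filter; filterᵇ; take; drop; null; foldr)
open import Data.Nat.ListAction using (sum)
open import Data.Bool.ListAction using (all; any)
open import Data.Maybe using (Maybe; just; nothing; _>>=_)
import Data.Maybe as Maybe
open import Data.Integer as ℤ using (ℤ; +_)
open import Data.Product using (_×_; _,_)
open import Data.List.Relation.Unary.All using (All)
open import Data.List.Relation.Unary.Linked using (Linked)
open import Data.List.Relation.Binary.Permutation.Propositional using (_↭_)
open import Relation.Binary.PropositionalEquality using (_≡_)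
open import Relation.Nullary.Decidable using (⌊_⌋; ¬?)

IsComposition : ℕ → List ℕ → Set
IsComposition n α = All (λ a → 1 ≤ a) α × sum α ≡ n

-- Small list helpers (all indices are 1-based, as in the paper)

_==_ : ℕ → ℕ → Bool
m == n = ⌊ m ≟ n ⌋

get : {A : Set} → A → List A → ℕ → A
get d []       _             = d
get d (x ∷ xs) zero          = d
get d (x ∷ xs) (suc zero)    = x
get d (x ∷ xs) (suc (suc i)) = get d xs (suc i)

oneTo : ℕ → List ℕ
oneTo ℓ = map suc (upTo ℓ)

between : ℕ → ℕ → List ℕ
between k ℓ = map (λ j → suc (k + j)) (upTo (ℓ ∸ k))

mem : ℕ → List ℕ → Bool
mem x = any (x ==_)

modifyAt : {A : Set} → ℕ → (A → A) → List A → List A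
modifyAt i f []                   = []
modifyAt zero f (x ∷ xs)          = x ∷ xs
modifyAt (suc zero) f (x ∷ xs)    = f x ∷ xs
modifyAt (suc (suc i)) f (x ∷ xs) = x ∷ modifyAt (suc i) f xs

dropLast : List ℕ → Maybe (List ℕ)
dropLast []           = nothing
dropLast (x ∷ [])     = just []
dropLast (x ∷ y ∷ xs) = Maybe.map (x ∷_) (dropLast (y ∷ xs))

insertAfter : {A : Set} → ℕ → A → List A → List A
insertAfter k a xs = take k xs ++ a ∷ drop k xs

deleteAt : {A : Set} → ℕ → List A → List A
deleteAt r xs = take (r ∸ 1) xs ++ drop r xs

indexOf : ℕ → List ℕ → Maybe ℕ
indexOf v []       = nothing
indexOf v (x ∷ xs) = if x == v then just 1 else Maybe.map suc (indexOf v xs)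

IsPerm : List ℕ → ℕ → Set
IsPerm σ ℓ = σ ↭ oneTo ℓ

-- one-line notation of s_q σ  (product composed right to left: (s_q σ)_i = s_q(σ_i))
sMul : ℕ → List ℕ → List ℕ
sMul q σ = map (λ x → if x == q then suc q else (if x == suc q then q else x)) σ

-- regard a permutation of S_{m+1} fixing m+1 as an element of S_m
-- (undefined if it does not fix m+1)
restrictPerm : List ℕ → Maybe (List ℕ)
restrictPerm σ = if get 0 σ (length σ) == length σ then just (take (length σ ∸ 1) σ) else nothing

-- Immaculate tableaux, represented as lists of rows (row 1 first)

headD : List ℕ → ℕ
headD []      = 0
headD (x ∷ _) = x

firstColumn : List (List ℕ) → List ℕ
firstColumn = map headD

shape : List (List ℕ) → List ℕ
shape = map length

record Immaculate (S : List (List ℕ)) : Set where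
  field
    rowsNonempty  : All (λ row → 1 ≤ length row) S
    entriesPos    : All (All (λ x → 1 ≤ x)) S
    rowsWeak      : All (Linked _≤_) S
    firstColStrict : Linked _<_ (firstColumn S)

count : ℕ → List (List ℕ) → ℕ
count v S = length (filterᵇ (v ==_) (concat S))

-- S has content β: value v occurs β_v times (0 times for v > ℓ(β))
HasContent : List (List ℕ) → List ℕ → Set
HasContent S β = ∀ v → 1 ≤ v → count v S ≡ get 0 β v

maxEntry : List (List ℕ) → ℕ
maxEntry S = foldr _⊔_ 0 (concat S)

-- Tunnel hook coverings.  A THC T of shape γ is determined by perm(T) ∈ S_ℓ
-- (T ↦ perm(T) is a bijection onto S_ℓ), so we represent it by the pair
-- (γ, perm(T)).

deltaFrom : ℕ → List ℕ → List ℕ → List ℤ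
deltaFrom i (g ∷ γ) (s ∷ σ) = ((+ g) ℤ.+ (+ s) ℤ.- (+ i)) ∷ deltaFrom (suc i) γ σ
deltaFrom i _ _ = []

Δ : List ℕ → List ℕ → List ℤ
Δ γ σ = deltaFrom 1 γ σ

fl : List ℤ → List ℤ
fl = filter (λ z → ¬? (z ℤ.≟ + 0))

thcContent : List ℕ → List ℕ → List ℤ
thcContent γ σ = fl (Δ γ σ)

-- C_{α,β}: pairs (T,S) of the same shape γ = sh(S); T is given by perm(T) = σ

InC : List ℕ → List ℕ → List ℕ × List (List ℕ) → Set
InC α β (σ , S) =
  Immaculate S × IsPerm σ (length S) × thcContent (shape S) σ ≡ map +_ α × HasContent S β

-- The map ψ_{α,β}.  It returns nothing exactly when some step of the
-- construction is not defined.

module _ (σ : List ℕ) (S : List (List ℕ)) where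
  private
    ℓ : ℕ
    ℓ = length S
    M : ℕ
    M = maxEntry S
    val : ℕ → ℕ
    val i = (M ∸ ℓ) + i
    row : ℕ → List ℕ
    row i = get [] S i

  goodIndex : ℕ → Bool
  goodIndex i = (get 0 σ i == i)
              ∧ all (_== val i) (row i)
              ∧ all (λ j → (j == i) ∨ not (mem (val i) (row j))) (oneTo ℓ)

  goodK : ℕ → Bool
  goodK k = all goodIndex (between k ℓ)

  firstGood : List ℕ → ℕ
  firstGood []       = ℓ
  firstGood (k ∷ ks) = if goodK k then k else firstGood ks

  -- step (1): smallest k ∈ {0,…,ℓ−1} with goodK k, else ℓ
  kOf : ℕ
  kOf = firstGood (upTo ℓ)

  argminσ : List ℕ → Maybe ℕ
  argminσ []       = nothing
  argminσ (j ∷ js) with argminσ js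
  ... | nothing = just j
  ... | just r  = if get 0 σ j ≤ᵇ get 0 σ r then just j else just r

  stepsFrom : ℕ → Maybe (List ℕ × List (List ℕ))
  stepsFrom zero = just (σ , S)
  stepsFrom k@(suc _) =
    argminσ (filterᵇ (λ j → mem (val k) (row j)) (oneTo ℓ)) >>= λ r →
    dropLast (row r) >>= λ row′ →
    let S₁ = modifyAt r (λ _ → row′) S in
    if get 0 σ r == k
    then just (sMul k (σ ++ [ suc ℓ ]) , insertAfter k [ val k ] S₁)      -- step (4)
    else                                                                  -- step (5)
      (let q = get 0 σ r in
       indexOf (suc q) σ >>= λ p →
       let U₀ = modifyAt p (_++ [ val k ]) S₁ in
       if null row′
       then (restrictPerm (sMul q σ) >>= λ τ → just (τ , deleteAt r U₀))
       else just (sMul q σ , U₀))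

  ψ : Maybe (List ℕ × List (List ℕ))
  ψ = stepsFrom kOf

-- Let k be the index chosen in step (1) and v = M − ℓ + k.  Minimality of k makes rows
-- k+1, …, ℓ rigid: σ fixes them and row i consists of copies of M − ℓ + i, a value occurring
-- nowhere else.  Hence every entry of rows 1, …, k is at most v, σ maps 1, …, k into itself,
-- and v, which occurs in S because β is a composition, sits in rows 1, …, k only, as the last
-- entry of each row containing it.  Removing that v from row r and putting it back elsewhere
-- moves one cell of the shape, and multiplying by s_q compensates exactly in Δ_i = γ_i + σ_i − i.
-- In step (4) the new row k+1 has Δ = 1 + k − (k+1) = 0 and the rows below it move down together
-- with their fixed points (row r cannot become empty there, for then k itself would satisfy
-- (a)–(c)).  In step (5) row r loses a cell while σ_r = q becomes q+1, and row p gains one while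
-- σ_p = q+1 becomes q.  If row r empties in step (5), then r = k, and Δ_r ≥ 0 (the nonzero
-- entries of Δ form α) forces q = k − 1, so s_q σ fixes ℓ and the deleted row had Δ = 0.
-- Thus fl(Δ) and the content are preserved, and the first column stays strictly increasing
-- because v lies below every entry of rows k+1, …, ℓ.

{-# OPTIONS --safe #-}
module Submission where

open import Defs
open import Data.Bool using (Bool; true; false; T; not; if_then_else_)
open import Data.Bool.Properties using (T-∧; T-∨)
open import Data.Nat using (ℕ; zero; suc; _+_; _∸_; _⊓_; _⊔_; _≤_; _<_; _≤ᵇ_; z≤n; s≤s; >-nonZero)
open import Data.Nat.Properties
open import Data.Integer as ℤ using (ℤ; +_; _⊖_)
import Data.Integer.Properties as ℤₚ
open import Data.List
  using ( List; []; _∷_; [_]; _++_; _∷ʳ_; map; length; concat; foldr; take; drop; upTo; applyUpTo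
        ; filterᵇ; null; initLast; _∷ʳ′_ )
open import Data.List.Properties
  using (length-++; ++-assoc; length-map; map-++; upTo-∷ʳ; length-upTo; map-id-local; length-take)
open import Data.List.Membership.Propositional using (_∈_; _∉_)
import Data.List.Membership.Propositional.Properties as ∈
open import Data.List.Relation.Unary.All as All using (All; []; _∷_)
open import Data.List.Relation.Unary.All.Properties using (all⁺; all⁻)
open import Data.List.Relation.Unary.Any as Any using (here; there)
open import Data.List.Relation.Unary.Any.Properties using (any⁺; any⁻)
open import Data.List.Relation.Unary.AllPairs using (_∷_)
open import Data.List.Relation.Unary.Linked using (Linked; []; [-]; _∷_)
open import Data.List.Relation.Unary.Linked.Properties using (Linked⇒All)
open import Data.List.Relation.Unary.Unique.Propositional using (Unique)
import Data.List.Relation.Unary.Unique.Propositional.Properties as Unique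
open import Data.List.Relation.Binary.Permutation.Propositional
  using (module PermutationReasoning; _↭_; ↭-refl; ↭-sym; ↭-trans; ↭-reflexive; swap; ↭⇒↭ₛ)
open import Data.List.Relation.Binary.Permutation.Propositional.Properties
  using (++⁺ˡ; ++⁺ʳ; shifts; filter-↭; ↭-length; ∈-resp-↭; drop-∷; ∷↭∷ʳ)
import Data.List.Relation.Binary.Permutation.Propositional.Properties as ↭
open import Data.Maybe using (Maybe; just; _>>=_)
import Data.Maybe as Maybe
open import Data.Product using (Σ; ∃-syntax; _×_; _,_; proj₁; proj₂)
open import Data.Sum using (_⊎_; inj₁; inj₂)
open import Data.Unit using (tt)
open import Function using (_∘_; flip; case_of_)
open import Function.Bundles using (module Equivalence)
open import Relation.Binary.Definitions using (Transitive; Reflexive)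
open import Relation.Binary.PropositionalEquality hiding ([_])
open import Relation.Nullary using (¬_; contradiction; yes; no)
open import Relation.Nullary.Decidable using (T?; ¬?; toWitness; fromWitness)
open import Data.List.Relation.Binary.Permutation.Setoid.Properties (setoid ℕ) using (Unique-resp-↭)

private variable
  A : Set
  R : A → A → Set

-- Lists indexed from 1

if-T : ∀ {b} {x y : A} → T b → (if b then x else y) ≡ x
if-T {b = true} _ = refl

if-¬T : ∀ {b} {x y : A} → ¬ T b → (if b then x else y) ≡ y
if-¬T {b = false} _  = refl
if-¬T {b = true}  ¬t = contradiction tt ¬t

==⇒≡ : ∀ {m n} → T (m == n) → m ≡ n
==⇒≡ {m} {n} = toWitness {a? = m ≟ n}

≡⇒== : ∀ {m n} → m ≡ n → T (m == n)
≡⇒== {m} {n} = fromWitness {a? = m ≟ n}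

T-not⇒¬T : ∀ {b} → T (not b) → ¬ T b
T-not⇒¬T {false} _ ()

¬T⇒T-not : ∀ {b} → ¬ T b → T (not b)
¬T⇒T-not {false} _  = _
¬T⇒T-not {true}  ¬t = ¬t _

mem⁻ : ∀ {x} xs → T (mem x xs) → x ∈ xs
mem⁻ xs t = Any.map ==⇒≡ (any⁻ _ xs t)

mem⁺ : ∀ {x xs} → x ∈ xs → T (mem x xs)
mem⁺ x∈ = any⁺ _ (Any.map ≡⇒== x∈)

>>=-just : ∀ {B : Set} {m : Maybe A} {x} (f : A → Maybe B) → m ≡ just x → (m >>= f) ≡ f x
>>=-just f refl = refl

row : List (List ℕ) → ℕ → List ℕ
row T i = get [] T i

_⟨_⟩ : List ℕ → ℕ → ℕ
σ ⟨ i ⟩ = get 0 σ i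

get-∈ : ∀ (d : A) xs {i} → 1 ≤ i → i ≤ length xs → get d xs i ∈ xs
get-∈ d (x ∷ xs) {suc zero}    _ _        = here refl
get-∈ d (x ∷ xs) {suc (suc i)} _ (s≤s i≤) = there (get-∈ d xs (s≤s z≤n) i≤)

∈⇒get : ∀ (d : A) {x} xs → x ∈ xs → ∃[ i ] 1 ≤ i × i ≤ length xs × get d xs i ≡ x
∈⇒get d (x ∷ xs) (here refl) = 1 , s≤s z≤n , s≤s z≤n , refl
∈⇒get d (x ∷ xs) (there x∈) with ∈⇒get d xs x∈
... | suc i , _ , i≤ , eq = suc (suc i) , s≤s z≤n , s≤s i≤ , eq

get-beyond : ∀ (d : A) xs {i} → length xs < i → get d xs i ≡ d
get-beyond d []       _                      = refl
get-beyond d (x ∷ xs) {suc (suc i)} (s≤s <i) = get-beyond d xs <i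

get-zero : ∀ (d : A) xs → get d xs 0 ≡ d
get-zero d []      = refl
get-zero d (_ ∷ _) = refl

get-map : ∀ {B : Set} (f : A → B) {d} xs i → get (f d) (map f xs) i ≡ f (get d xs i)
get-map f []       i             = refl
get-map f (x ∷ xs) zero          = refl
get-map f (x ∷ xs) (suc zero)    = refl
get-map f (x ∷ xs) (suc (suc i)) = get-map f xs (suc i)

get-++ˡ : ∀ (d : A) xs ys {i} → i ≤ length xs → get d (xs ++ ys) i ≡ get d xs i
get-++ˡ d []       ys {zero}        _        = get-zero d ys
get-++ˡ d (x ∷ xs) ys {zero}        _        = refl
get-++ˡ d (x ∷ xs) ys {suc zero}    _        = refl
get-++ˡ d (x ∷ xs) ys {suc (suc i)} (s≤s i≤) = get-++ˡ d xs ys i≤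

get-∷ʳ-last : ∀ (d : A) xs y → get d (xs ∷ʳ y) (suc (length xs)) ≡ y
get-∷ʳ-last d []            y = refl
get-∷ʳ-last d (x ∷ [])      y = refl
get-∷ʳ-last d (x ∷ x′ ∷ xs) y = get-∷ʳ-last d (x′ ∷ xs) y

get-take : ∀ (d : A) m xs {i} → i ≤ m → get d (take m xs) i ≡ get d xs i
get-take d zero          []       _                      = refl
get-take d (suc m)       []       _                      = refl
get-take d zero          (x ∷ xs) {zero}        _        = refl
get-take d (suc m)       (x ∷ xs) {zero}        _        = refl
get-take d (suc m)       (x ∷ xs) {suc zero}    _        = refl
get-take d (suc (suc m)) (x ∷ xs) {suc (suc i)} (s≤s i≤) = get-take d (suc m) xs i≤

get-extensionality : ∀ (d : A) xs ys → length xs ≡ length ys →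
                     (∀ i → 1 ≤ i → i ≤ length xs → get d xs i ≡ get d ys i) → xs ≡ ys
get-extensionality d []       []       _   _  = refl
get-extensionality d (x ∷ xs) (y ∷ ys) len eq =
  cong₂ _∷_ (eq 1 (s≤s z≤n) (s≤s z≤n))
            (get-extensionality d xs ys (suc-injective len)
              λ { (suc i) _ i≤ → eq (suc (suc i)) (s≤s z≤n) (s≤s i≤) })

All-by-get : ∀ {P : A → Set} (d : A) xs → (∀ i → 1 ≤ i → i ≤ length xs → P (get d xs i)) → All P xs
All-by-get {P = P} d xs P-get = All.tabulate λ x∈ →
  let i , 1≤i , i≤ , get≡ = ∈⇒get d xs x∈ in subst P get≡ (P-get i 1≤i i≤)

≡-take-∷ʳ-last : ∀ (d : A) m xs → length xs ≡ suc m → xs ≡ take m xs ∷ʳ get d xs (suc m)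
≡-take-∷ʳ-last d zero    (x ∷ [])     _   = refl
≡-take-∷ʳ-last d (suc m) (x ∷ x′ ∷ xs) len =
  cong (x ∷_) (≡-take-∷ʳ-last d m (x′ ∷ xs) (suc-injective len))

length-∷ʳ : ∀ xs (x : A) → length (xs ∷ʳ x) ≡ suc (length xs)
length-∷ʳ xs x = trans (length-++ xs) (+-comm (length xs) 1)

∈⇒1≤length : ∀ {x : A} {xs} → x ∈ xs → 1 ≤ length xs
∈⇒1≤length (here _)  = s≤s z≤n
∈⇒1≤length (there _) = s≤s z≤n

1≤length⇒∈ : ∀ {xs : List A} → 1 ≤ length xs → ∃[ x ] x ∈ xs
1≤length⇒∈ {xs = x ∷ _} _ = x , here refl

[]-or-nonempty : ∀ (xs : List A) → xs ≡ [] ⊎ 1 ≤ length xs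
[]-or-nonempty []      = inj₁ refl
[]-or-nonempty (_ ∷ _) = inj₂ (s≤s z≤n)

nonempty⇒¬null : ∀ {xs : List A} → 1 ≤ length xs → ¬ T (null xs)
nonempty⇒¬null {xs = _ ∷ _} _ ()

nonempty⇒∷ʳ : ∀ {xs : List A} → 1 ≤ length xs → ∃[ ys ] ∃[ z ] xs ≡ ys ∷ʳ z
nonempty⇒∷ʳ {xs = xs} 1≤ with initLast xs
... | []       = contradiction 1≤ λ ()
... | ys ∷ʳ′ z = ys , z , refl

head-∷ʳ : ∀ xs y → 1 ≤ length xs → headD (xs ∷ʳ y) ≡ headD xs
head-∷ʳ (x ∷ xs) y _ = refl

data Position (k : ℕ) : ℕ → Set where
  below : ∀ {i} → i ≤ k → Position k i
  at    : Position k (suc k)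
  above : ∀ {i} → k < i → Position k (suc i)

position : ∀ k i → Position k i
position k       zero          = below z≤n
position zero    (suc zero)    = at
position zero    (suc (suc i)) = above (s≤s z≤n)
position (suc k) (suc i) with position k i
... | below i≤k = below (s≤s i≤k)
... | at        = at
... | above k<i = above (s≤s k<i)

length-modifyAt : ∀ r (f : A → A) xs → length (modifyAt r f xs) ≡ length xs
length-modifyAt r             f []       = refl
length-modifyAt zero          f (x ∷ xs) = refl
length-modifyAt (suc zero)    f (x ∷ xs) = refl
length-modifyAt (suc (suc r)) f (x ∷ xs) = cong suc (length-modifyAt (suc r) f xs)

get-modifyAt-≡ : ∀ (d : A) r f xs → 1 ≤ r → r ≤ length xs → get d (modifyAt r f xs) r ≡ f (get d xs r)
get-modifyAt-≡ d (suc zero)    f (x ∷ xs) _ _        = refl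
get-modifyAt-≡ d (suc (suc r)) f (x ∷ xs) _ (s≤s r≤) = get-modifyAt-≡ d (suc r) f xs (s≤s z≤n) r≤

get-modifyAt-≢ : ∀ (d : A) r f xs i → i ≢ r → get d (modifyAt r f xs) i ≡ get d xs i
get-modifyAt-≢ d r             f []       i             _   = refl
get-modifyAt-≢ d zero          f (x ∷ xs) i             _   = refl
get-modifyAt-≢ d (suc zero)    f (x ∷ xs) zero          _   = refl
get-modifyAt-≢ d (suc (suc r)) f (x ∷ xs) zero          _   = refl
get-modifyAt-≢ d (suc zero)    f (x ∷ xs) (suc zero)    i≢r = contradiction refl i≢r
get-modifyAt-≢ d (suc zero)    f (x ∷ xs) (suc (suc i)) _   = refl
get-modifyAt-≢ d (suc (suc r)) f (x ∷ xs) (suc zero)    _   = refl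
get-modifyAt-≢ d (suc (suc r)) f (x ∷ xs) (suc (suc i)) i≢r =
  get-modifyAt-≢ d (suc r) f xs (suc i) (i≢r ∘ cong suc)

length-insertAfter : ∀ k (a : A) xs → k ≤ length xs → length (insertAfter k a xs) ≡ suc (length xs)
length-insertAfter zero    a xs       _        = refl
length-insertAfter (suc k) a (x ∷ xs) (s≤s k≤) = cong suc (length-insertAfter k a xs k≤)

get-insertAfter-≤ : ∀ (d : A) k a xs {i} → k ≤ length xs → i ≤ k →
                    get d (insertAfter k a xs) i ≡ get d xs i
get-insertAfter-≤ d zero    a xs       {zero}        _        _        = sym (get-zero d xs)
get-insertAfter-≤ d (suc k) a (x ∷ xs) {zero}        _        _        = refl
get-insertAfter-≤ d (suc k) a (x ∷ xs) {suc zero}    _        _        = refl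
get-insertAfter-≤ d (suc k) a (x ∷ xs) {suc (suc i)} (s≤s k≤) (s≤s i≤) = get-insertAfter-≤ d k a xs k≤ i≤

get-insertAfter-suc : ∀ (d : A) k a xs → k ≤ length xs → get d (insertAfter k a xs) (suc k) ≡ a
get-insertAfter-suc d zero    a xs       _        = refl
get-insertAfter-suc d (suc k) a (x ∷ xs) (s≤s k≤) = get-insertAfter-suc d k a xs k≤

get-insertAfter-> : ∀ (d : A) k a xs {i} → k < i → get d (insertAfter k a xs) (suc i) ≡ get d xs i
get-insertAfter-> d zero    a xs       {suc i}       _        = refl
get-insertAfter-> d (suc k) a xs       {suc zero}    (s≤s ())
get-insertAfter-> d (suc k) a []       {suc (suc i)} _        = refl
get-insertAfter-> d (suc k) a (x ∷ xs) {suc (suc i)} (s≤s k<) = get-insertAfter-> d k a xs k<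

length-deleteAt : ∀ r (xs : List A) → 1 ≤ r → r ≤ length xs → suc (length (deleteAt r xs)) ≡ length xs
length-deleteAt (suc zero)    (x ∷ xs) _ _        = refl
length-deleteAt (suc (suc r)) (x ∷ xs) _ (s≤s r≤) = cong suc (length-deleteAt (suc r) xs (s≤s z≤n) r≤)

get-deleteAt-< : ∀ (d : A) r xs {i} → i < r → get d (deleteAt r xs) i ≡ get d xs i
get-deleteAt-< d (suc zero)    xs       {zero}        _        = trans (get-zero d (drop 1 xs)) (sym (get-zero d xs))
get-deleteAt-< d (suc zero)    xs       {suc i}       (s≤s ())
get-deleteAt-< d (suc (suc r)) []       {i}           _        = refl
get-deleteAt-< d (suc (suc r)) (x ∷ xs) {zero}        _        = refl
get-deleteAt-< d (suc (suc r)) (x ∷ xs) {suc zero}    _        = refl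
get-deleteAt-< d (suc (suc r)) (x ∷ xs) {suc (suc i)} (s≤s i<) = get-deleteAt-< d (suc r) xs i<

get-deleteAt-≥ : ∀ (d : A) r xs {i} → 1 ≤ r → r ≤ i → get d (deleteAt r xs) i ≡ get d xs (suc i)
get-deleteAt-≥ d (suc zero)    []       {i}           _ _        = refl
get-deleteAt-≥ d (suc zero)    (x ∷ xs) {suc i}       _ _        = refl
get-deleteAt-≥ d (suc (suc r)) []       {i}           _ _        = refl
get-deleteAt-≥ d (suc (suc r)) (x ∷ xs) {suc (suc i)} _ (s≤s r≤) =
  get-deleteAt-≥ d (suc r) xs (s≤s z≤n) r≤

indexOf-complete : ∀ {y} xs → y ∈ xs →
                   ∃[ p ] indexOf y xs ≡ just p × 1 ≤ p × p ≤ length xs × get 0 xs p ≡ y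
indexOf-complete {y} (x ∷ xs) y∈ with x == y in eq
... | true = 1 , refl , s≤s z≤n , s≤s z≤n , ==⇒≡ (subst T (sym eq) tt)
... | false with y∈
...   | here refl = contradiction (≡⇒== refl) (subst T eq)
...   | there y∈xs with indexOf-complete xs y∈xs
...     | suc p , eq′ , _ , p≤ , get≡ =
  suc (suc p) , cong (Maybe.map suc) eq′ , s≤s z≤n , s≤s p≤ , get≡

dropLast-∷ʳ : ∀ (xs : List ℕ) y → dropLast (xs ∷ʳ y) ≡ just xs
dropLast-∷ʳ []            y = refl
dropLast-∷ʳ (x ∷ [])      y = refl
dropLast-∷ʳ (x ∷ x′ ∷ xs) y = cong (Maybe.map (x ∷_)) (dropLast-∷ʳ (x′ ∷ xs) y)

concat-insertAfter-↭ : ∀ k (ys : List A) xss → concat (insertAfter k ys xss) ↭ ys ++ concat xss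
concat-insertAfter-↭ zero    ys xss        = ↭-refl
concat-insertAfter-↭ (suc k) ys []         = ↭-refl
concat-insertAfter-↭ (suc k) ys (xs ∷ xss) =
  ↭-trans (++⁺ˡ xs (concat-insertAfter-↭ k ys xss)) (shifts xs ys)

concat-modifyAt-↭ : ∀ r f (xss : List (List A)) {ys zs} → 1 ≤ r → r ≤ length xss →
                    ys ++ f (get [] xss r) ↭ zs ++ get [] xss r →
                    ys ++ concat (modifyAt r f xss) ↭ zs ++ concat xss
concat-modifyAt-↭ (suc zero) f (xs ∷ xss) {ys} {zs} _ _ p = begin
  ys ++ f xs ++ concat xss   ≡⟨ ++-assoc ys (f xs) _ ⟨
  (ys ++ f xs) ++ concat xss ↭⟨ ++⁺ʳ (concat xss) p ⟩
  (zs ++ xs) ++ concat xss   ≡⟨ ++-assoc zs xs _ ⟩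
  zs ++ xs ++ concat xss     ∎
  where open PermutationReasoning
concat-modifyAt-↭ (suc (suc r)) f (xs ∷ xss) {ys} {zs} _ (s≤s r≤) p = begin
  ys ++ xs ++ concat (modifyAt (suc r) f xss)
    ↭⟨ shifts ys xs ⟩
  xs ++ ys ++ concat (modifyAt (suc r) f xss)
    ↭⟨ ++⁺ˡ xs (concat-modifyAt-↭ (suc r) f xss (s≤s z≤n) r≤ p) ⟩
  xs ++ zs ++ concat xss
    ↭⟨ shifts xs zs ⟩
  zs ++ xs ++ concat xss
    ∎
  where open PermutationReasoning

concat-deleteAt-[] : ∀ r (xss : List (List A)) → get [] xss r ≡ [] → concat (deleteAt r xss) ≡ concat xss
concat-deleteAt-[] zero          xss        _    = refl
concat-deleteAt-[] (suc zero)    []         _    = refl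
concat-deleteAt-[] (suc zero)    (xs ∷ xss) refl = refl
concat-deleteAt-[] (suc (suc r)) []         _    = refl
concat-deleteAt-[] (suc (suc r)) (xs ∷ xss) eq   = cong (xs ++_) (concat-deleteAt-[] (suc r) xss eq)

fl-insertAfter-0 : ∀ k zs → fl (insertAfter k (+ 0) zs) ≡ fl zs
fl-insertAfter-0 zero    zs       = refl
fl-insertAfter-0 (suc k) []       = refl
fl-insertAfter-0 (suc k) (z ∷ zs) with z ℤ.≟ + 0
... | yes _ = fl-insertAfter-0 k zs
... | no  _ = cong (z ∷_) (fl-insertAfter-0 k zs)

fl-deleteAt-0 : ∀ r zs → get (+ 0) zs r ≡ + 0 → fl (deleteAt r zs) ≡ fl zs
fl-deleteAt-0 zero          zs       _    = refl
fl-deleteAt-0 (suc zero)    []       _    = refl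
fl-deleteAt-0 (suc zero)    (z ∷ zs) refl = refl
fl-deleteAt-0 (suc (suc r)) []       _    = refl
fl-deleteAt-0 (suc (suc r)) (z ∷ zs) zero≡ with z ℤ.≟ + 0
... | yes _ = fl-deleteAt-0 (suc r) zs zero≡
... | no  _ = cong (z ∷_) (fl-deleteAt-0 (suc r) zs zero≡)

Linked-get : ∀ (d : A) {xs} → Linked R xs → ∀ {i} → 1 ≤ i → suc i ≤ length xs →
             R (get d xs i) (get d xs (suc i))
Linked-get d [-]       {suc zero}    _ (s≤s ())
Linked-get d (Rxy ∷ _) {suc zero}    _ _        = Rxy
Linked-get d (_ ∷ l)   {suc (suc i)} _ (s≤s i<) = Linked-get d l (s≤s z≤n) i<

get⇒Linked : ∀ (d : A) xs → (∀ i → 1 ≤ i → suc i ≤ length xs → R (get d xs i) (get d xs (suc i))) →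
             Linked R xs
get⇒Linked d []           _ = []
get⇒Linked d (x ∷ [])     _ = [-]
get⇒Linked d (x ∷ y ∷ xs) R-get =
  R-get 1 (s≤s z≤n) (s≤s (s≤s z≤n)) ∷
  get⇒Linked d (y ∷ xs) λ { (suc i) _ i< → R-get (suc (suc i)) (s≤s z≤n) (s≤s i<) }

Linked-get-< : ∀ (d : A) → Transitive R → ∀ {xs} → Linked R xs →
               ∀ {i j} → 1 ≤ i → i < j → j ≤ length xs → R (get d xs i) (get d xs j)
Linked-get-< d R-trans l {i} {suc j} 1≤i (s≤s i≤j) j< with m≤n⇒m<n∨m≡n i≤j
... | inj₂ refl = Linked-get d l 1≤i j<
... | inj₁ i<j  = R-trans (Linked-get-< d R-trans l 1≤i i<j (≤-trans (n≤1+n j) j<))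
                          (Linked-get d l (≤-trans 1≤i (<⇒≤ i<j)) j<)

Linked-∷ʳ⁻ : ∀ xs {z : A} → Linked R (xs ∷ʳ z) → Linked R xs
Linked-∷ʳ⁻ []           _         = []
Linked-∷ʳ⁻ (x ∷ [])     _         = [-]
Linked-∷ʳ⁻ (x ∷ y ∷ xs) (Rxy ∷ l) = Rxy ∷ Linked-∷ʳ⁻ (y ∷ xs) l

Linked-∷ʳ⁺ : ∀ {xs} {z : A} → Linked R xs → All (λ y → R y z) xs → Linked R (xs ∷ʳ z)
Linked-∷ʳ⁺ []        _          = [-]
Linked-∷ʳ⁺ [-]       (Rxz ∷ []) = Rxz ∷ [-]
Linked-∷ʳ⁺ (Rxy ∷ l) (_ ∷ Ryz)  = Rxy ∷ Linked-∷ʳ⁺ l Ryz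

Linked-∷ʳ⇒All : Transitive R → Reflexive R → ∀ xs {z : A} →
                Linked R (xs ∷ʳ z) → All (λ y → R y z) (xs ∷ʳ z)
Linked-∷ʳ⇒All R-trans R-refl []           _         = R-refl ∷ []
Linked-∷ʳ⇒All R-trans R-refl (x ∷ [])     (Rxz ∷ _) = Rxz ∷ R-refl ∷ []
Linked-∷ʳ⇒All R-trans R-refl (x ∷ y ∷ xs) (Rxy ∷ l) with Linked-∷ʳ⇒All R-trans R-refl (y ∷ xs) l
... | Ryz ∷ Rs = R-trans Rxy Ryz ∷ Ryz ∷ Rs

-- Permutations of 1, …, m

oneTo-suc : ∀ m → oneTo (suc m) ≡ oneTo m ∷ʳ suc m
oneTo-suc m = trans (cong (map suc) (sym (upTo-∷ʳ m))) (map-++ suc (upTo m) [ m ])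

length-oneTo : ∀ m → length (oneTo m) ≡ m
length-oneTo m = trans (length-map suc (upTo m)) (length-upTo m)

∈-oneTo⁻ : ∀ {x} m → x ∈ oneTo m → 1 ≤ x × x ≤ m
∈-oneTo⁻ m x∈ with ∈.∈-map⁻ suc x∈
... | _ , y∈ , refl = s≤s z≤n , ∈.∈-upTo⁻ y∈

∈-oneTo⁺ : ∀ {x} m → 1 ≤ x → x ≤ m → x ∈ oneTo m
∈-oneTo⁺ {suc x} m _ x≤m = ∈.∈-map⁺ suc (∈.∈-upTo⁺ x≤m)

Unique-oneTo : ∀ m → Unique (oneTo m)
Unique-oneTo m = Unique.map⁺ suc-injective (Unique.upTo⁺ m)

get-injective : ∀ (d : A) {xs} → Unique xs →
                ∀ {i j} → 1 ≤ i → i ≤ length xs → 1 ≤ j → j ≤ length xs → get d xs i ≡ get d xs j → i ≡ j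
get-injective d (_ ∷ _) {suc zero} {suc zero} _ _ _ _ _ = refl
get-injective d {x ∷ xs} (x∉ ∷ _) {suc zero} {suc (suc j)} _ _ _ (s≤s j≤) eq =
  contradiction eq (All.lookup x∉ (get-∈ d xs (s≤s z≤n) j≤))
get-injective d {x ∷ xs} (x∉ ∷ _) {suc (suc i)} {suc zero} _ (s≤s i≤) _ _ eq =
  contradiction (sym eq) (All.lookup x∉ (get-∈ d xs (s≤s z≤n) i≤))
get-injective d (_ ∷ u) {suc (suc i)} {suc (suc j)} _ (s≤s i≤) _ (s≤s j≤) eq =
  cong suc (get-injective d u (s≤s z≤n) i≤ (s≤s z≤n) j≤ eq)

module Permutation {σ : List ℕ} {m : ℕ} (σ↭ : σ ↭ oneTo m) where

  length≡ : length σ ≡ m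
  length≡ = trans (↭-length σ↭) (length-oneTo m)

  get-range : ∀ {i} → 1 ≤ i → i ≤ m → 1 ≤ σ ⟨ i ⟩ × σ ⟨ i ⟩ ≤ m
  get-range 1≤i i≤m =
    ∈-oneTo⁻ m (∈-resp-↭ σ↭ (get-∈ 0 σ 1≤i (subst (_ ≤_) (sym length≡) i≤m)))

  injective : ∀ {i j} → 1 ≤ i → i ≤ m → 1 ≤ j → j ≤ m → σ ⟨ i ⟩ ≡ σ ⟨ j ⟩ → i ≡ j
  injective 1≤i i≤m 1≤j j≤m =
    get-injective 0 (Unique-resp-↭ (↭⇒↭ₛ (↭-sym σ↭)) (Unique-oneTo m))
      1≤i (subst (_ ≤_) (sym length≡) i≤m) 1≤j (subst (_ ≤_) (sym length≡) j≤m)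

  indexOf-total : ∀ {y} → 1 ≤ y → y ≤ m →
                  ∃[ p ] indexOf y σ ≡ just p × 1 ≤ p × p ≤ m × σ ⟨ p ⟩ ≡ y
  indexOf-total 1≤y y≤m with indexOf-complete σ (∈-resp-↭ (↭-sym σ↭) (∈-oneTo⁺ m 1≤y y≤m))
  ... | p , eq , 1≤p , p≤ , get≡ = p , eq , 1≤p , subst (p ≤_) length≡ p≤ , get≡

-- sMul q σ unfolds to map (transpose q) σ.
transpose : ℕ → ℕ → ℕ
transpose q x = if x == q then suc q else (if x == suc q then q else x)

transpose-q : ∀ q → transpose q q ≡ suc q
transpose-q q = if-T {b = q == q} (≡⇒== refl)

transpose-suc : ∀ q → transpose q (suc q) ≡ q
transpose-suc q =
  trans (if-¬T {b = suc q == q} (1+n≢n ∘ ==⇒≡)) (if-T {b = suc q == suc q} (≡⇒== refl))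

transpose-other : ∀ q {x} → x ≢ q → x ≢ suc q → transpose q x ≡ x
transpose-other q {x} x≢q x≢1+q =
  trans (if-¬T {b = x == q} (x≢q ∘ ==⇒≡)) (if-¬T {b = x == suc q} (x≢1+q ∘ ==⇒≡))

get-sMul : ∀ q σ i → 1 ≤ q → sMul q σ ⟨ i ⟩ ≡ transpose q (σ ⟨ i ⟩)
get-sMul q σ i 1≤q =
  trans (cong (λ d → get d (sMul q σ) i) (sym (transpose-other q (<⇒≢ 1≤q) (λ ()))))
        (get-map (transpose q) σ i)

map-transpose-oneTo : ∀ q m → 1 ≤ q → suc q ≤ m → map (transpose q) (oneTo m) ↭ oneTo m
map-transpose-oneTo q (suc m) 1≤q (s≤s q≤m) with m≤n⇒m<n∨m≡n q≤m
... | inj₁ q<m = begin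
  map (transpose q) (oneTo (suc m))                    ≡⟨ cong (map (transpose q)) (oneTo-suc m) ⟩
  map (transpose q) (oneTo m ∷ʳ suc m)                 ≡⟨ map-++ (transpose q) (oneTo m) [ suc m ] ⟩
  map (transpose q) (oneTo m) ∷ʳ transpose q (suc m)   ≡⟨ cong (map (transpose q) (oneTo m) ∷ʳ_) fixed ⟩
  map (transpose q) (oneTo m) ∷ʳ suc m                 ↭⟨ ++⁺ʳ [ suc m ] (map-transpose-oneTo q m 1≤q q<m) ⟩
  oneTo m ∷ʳ suc m                                     ≡⟨ oneTo-suc m ⟨
  oneTo (suc m)                                        ∎
  where
  open PermutationReasoning
  fixed : transpose q (suc m) ≡ suc m
  fixed = transpose-other q (<⇒≢ (m<n⇒m<1+n q<m) ∘ sym) (<⇒≢ q<m ∘ sym ∘ suc-injective)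
map-transpose-oneTo (suc q) (suc (suc q)) _ _ | inj₂ refl = begin
  map t (oneTo (suc (suc q)))                          ≡⟨ cong (map t) split ⟩
  map t (oneTo q ++ suc q ∷ suc (suc q) ∷ [])          ≡⟨ map-++ t (oneTo q) _ ⟩
  map t (oneTo q) ++ t (suc q) ∷ t (suc (suc q)) ∷ []  ≡⟨ cong₂ _++_ fixed swapped ⟩
  oneTo q ++ suc (suc q) ∷ suc q ∷ []                  ↭⟨ ++⁺ˡ (oneTo q) (swap _ _ ↭-refl) ⟩
  oneTo q ++ suc q ∷ suc (suc q) ∷ []                  ≡⟨ split ⟨
  oneTo (suc (suc q))                                  ∎
  where
  open PermutationReasoning
  t = transpose (suc q)
  split : oneTo (suc (suc q)) ≡ oneTo q ++ suc q ∷ suc (suc q) ∷ []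
  split = trans (oneTo-suc (suc q)) (trans (cong (_∷ʳ suc (suc q)) (oneTo-suc q)) (++-assoc (oneTo q) _ _))
  fixed : map t (oneTo q) ≡ oneTo q
  fixed = map-id-local (All.tabulate λ x∈ → let _ , x≤q = ∈-oneTo⁻ q x∈ in
            transpose-other (suc q) (<⇒≢ (s≤s x≤q)) (<⇒≢ (m<n⇒m<1+n (s≤s x≤q))))
  swapped : t (suc q) ∷ t (suc (suc q)) ∷ [] ≡ suc (suc q) ∷ suc q ∷ []
  swapped = cong₂ (λ a b → a ∷ b ∷ []) (transpose-q (suc q)) (transpose-suc (suc q))

sMul-↭ : ∀ q {σ m} → 1 ≤ q → suc q ≤ m → σ ↭ oneTo m → sMul q σ ↭ oneTo m
sMul-↭ q 1≤q q<m σ↭ = ↭-trans (↭.map⁺ (transpose q) σ↭) (map-transpose-oneTo q _ 1≤q q<m)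

∷ʳ-↭-oneTo : ∀ {σ m} → σ ↭ oneTo m → σ ∷ʳ suc m ↭ oneTo (suc m)
∷ʳ-↭-oneTo {m = m} σ↭ = ↭-trans (++⁺ʳ [ suc m ] σ↭) (↭-reflexive (sym (oneTo-suc m)))

take-↭-oneTo : ∀ {xs} m → xs ↭ oneTo (suc m) → xs ⟨ suc m ⟩ ≡ suc m → take m xs ↭ oneTo m
take-↭-oneTo {xs} m xs↭ last≡ = drop-∷ (begin
  suc m ∷ take m xs              ↭⟨ ∷↭∷ʳ (suc m) (take m xs) ⟩
  take m xs ∷ʳ suc m             ≡⟨ cong (take m xs ∷ʳ_) last≡ ⟨
  take m xs ∷ʳ get 0 xs (suc m)  ≡⟨ ≡-take-∷ʳ-last 0 m xs (Permutation.length≡ xs↭) ⟨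
  xs                             ↭⟨ xs↭ ⟩
  oneTo (suc m)                  ≡⟨ oneTo-suc m ⟩
  oneTo m ∷ʳ suc m               ↭⟨ ∷↭∷ʳ (suc m) (oneTo m) ⟨
  suc m ∷ oneTo m                ∎)
  where open PermutationReasoning

restrictPerm-fixed : ∀ xs {m} → length xs ≡ m → xs ⟨ m ⟩ ≡ m →
                     restrictPerm xs ≡ just (take (m ∸ 1) xs)
restrictPerm-fixed xs refl fixed = if-T {b = get 0 xs (length xs) == length xs} (≡⇒== fixed)

-- Immaculate tableaux

∈⇒≤foldr-⊔ : ∀ {x} xs → x ∈ xs → x ≤ foldr _⊔_ 0 xs
∈⇒≤foldr-⊔ (y ∷ xs) (here refl) = m≤m⊔n y _
∈⇒≤foldr-⊔ (y ∷ xs) (there x∈)  = ≤-trans (∈⇒≤foldr-⊔ xs x∈) (m≤n⊔m y _)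

foldr-⊔-lub : ∀ {b} xs → All (_≤ b) xs → foldr _⊔_ 0 xs ≤ b
foldr-⊔-lub []       []          = z≤n
foldr-⊔-lub (y ∷ xs) (y≤ ∷ xs≤) = ⊔-lub y≤ (foldr-⊔-lub xs xs≤)

∈⇒1≤count : ∀ {v} S → v ∈ concat S → 1 ≤ count v S
∈⇒1≤count {v} S v∈ = ∈⇒1≤length (∈.∈-filter⁺ (T? ∘ (v ==_)) v∈ (≡⇒== refl))

1≤count⇒∈ : ∀ {v} S → 1 ≤ count v S → v ∈ concat S
1≤count⇒∈ {v} S 1≤count with 1≤length⇒∈ 1≤count
... | x , x∈ with ∈.∈-filter⁻ (T? ∘ (v ==_)) x∈
...   | x∈S , v≡x rewrite ==⇒≡ v≡x = x∈S

HasContent-resp-↭ : ∀ S U β → concat S ↭ concat U → HasContent S β → HasContent U β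
HasContent-resp-↭ S U β S↭U content v 1≤v =
  trans (sym (↭-length (filter-↭ (T? ∘ (v ==_)) S↭U))) (content v 1≤v)

IsTableauRow : List ℕ → Set
IsTableauRow xs = 1 ≤ length xs × All (1 ≤_) xs × Linked _≤_ xs

Immaculate-by-rows : ∀ U → (∀ i → 1 ≤ i → i ≤ length U → IsTableauRow (row U i)) →
                     (∀ i → 1 ≤ i → suc i ≤ length U → headD (row U i) < headD (row U (suc i))) →
                     Immaculate U
Immaculate-by-rows U rows heads = record
  { rowsNonempty   = All-by-get [] U λ i 1≤i i≤ → proj₁ (rows i 1≤i i≤)
  ; entriesPos     = All-by-get [] U λ i 1≤i i≤ → proj₁ (proj₂ (rows i 1≤i i≤))
  ; rowsWeak       = All-by-get [] U λ i 1≤i i≤ → proj₂ (proj₂ (rows i 1≤i i≤))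
  ; firstColStrict = get⇒Linked 0 (firstColumn U) λ i 1≤i i< →
      subst₂ _<_ (sym (get-map headD U i)) (sym (get-map headD U (suc i)))
                 (heads i 1≤i (subst (suc i ≤_) (length-map headD U) i<))
  }

module ImmaculateTableau {S : List (List ℕ)} (imm : Immaculate S) where
  open Immaculate imm

  ∈-row⇒index : ∀ {j x} → x ∈ row S j → 1 ≤ j × j ≤ length S
  ∈-row⇒index {zero} x∈ rewrite get-zero [] S with () ← x∈
  ∈-row⇒index {suc j} x∈ with suc j ≤? length S
  ... | yes j≤ℓ = s≤s z≤n , j≤ℓ
  ... | no  j≰ℓ rewrite get-beyond [] S (≰⇒> j≰ℓ) with () ← x∈

  row-∈ : ∀ {j} → 1 ≤ j → j ≤ length S → row S j ∈ S
  row-∈ = get-∈ [] S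

  row-nonempty : ∀ {j} → 1 ≤ j → j ≤ length S → 1 ≤ length (row S j)
  row-nonempty 1≤j j≤ℓ = All.lookup rowsNonempty (row-∈ 1≤j j≤ℓ)

  row-sorted : ∀ {j} → 1 ≤ j → j ≤ length S → Linked _≤_ (row S j)
  row-sorted 1≤j j≤ℓ = All.lookup rowsWeak (row-∈ 1≤j j≤ℓ)

  row-positive : ∀ {j x} → x ∈ row S j → 1 ≤ x
  row-positive x∈ =
    let 1≤j , j≤ℓ = ∈-row⇒index x∈ in All.lookup (All.lookup entriesPos (row-∈ 1≤j j≤ℓ)) x∈

  row-isTableauRow : ∀ {j} → 1 ≤ j → j ≤ length S → IsTableauRow (row S j)
  row-isTableauRow 1≤j j≤ℓ = row-nonempty 1≤j j≤ℓ , All.tabulate row-positive , row-sorted 1≤j j≤ℓ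

  ∈-row⇒∈-concat : ∀ {j x} → x ∈ row S j → x ∈ concat S
  ∈-row⇒∈-concat x∈ = let 1≤j , j≤ℓ = ∈-row⇒index x∈ in ∈.∈-concat⁺′ x∈ (row-∈ 1≤j j≤ℓ)

  ∈-concat⇒∈-row : ∀ {x} → x ∈ concat S → ∃[ j ] x ∈ row S j
  ∈-concat⇒∈-row x∈ with ∈.∈-concat⁻′ S x∈
  ... | xs , x∈xs , xs∈S with ∈⇒get [] S xs∈S
  ...   | j , _ , _ , refl = j , x∈xs

  ≤maxEntry : ∀ {j x} → x ∈ row S j → x ≤ maxEntry S
  ≤maxEntry = ∈⇒≤foldr-⊔ (concat S) ∘ ∈-row⇒∈-concat

  head-< : ∀ {i j} → 1 ≤ i → i < j → j ≤ length S → headD (row S i) < headD (row S j)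
  head-< {i} {j} 1≤i i<j j≤ℓ = subst₂ _<_ (get-map headD S i) (get-map headD S j)
    (Linked-get-< 0 <-trans firstColStrict 1≤i i<j (subst (j ≤_) (sym (length-map headD S)) j≤ℓ))

  head-∈ : ∀ {j} → 1 ≤ j → j ≤ length S → headD (row S j) ∈ row S j
  head-∈ {j} 1≤j j≤ℓ with row S j | row-nonempty 1≤j j≤ℓ
  ... | x ∷ _ | _ = here refl

  head-≤ : ∀ {j x} → 1 ≤ j → j ≤ length S → x ∈ row S j → headD (row S j) ≤ x
  head-≤ {j} 1≤j j≤ℓ x∈ with row S j | row-sorted 1≤j j≤ℓ
  ... | y ∷ _ | sorted = All.lookup (Linked⇒All ≤-trans ≤-refl sorted) x∈

  index≤head : ∀ {j} → 1 ≤ j → j ≤ length S → j ≤ headD (row S j)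
  index≤head {suc zero}    _ j≤ℓ = row-positive (head-∈ (s≤s z≤n) j≤ℓ)
  index≤head {suc (suc j)} _ j≤ℓ =
    ≤-trans (s≤s (index≤head (s≤s z≤n) (≤-trans (n≤1+n _) j≤ℓ))) (head-< (s≤s z≤n) ≤-refl j≤ℓ)

  length≤maxEntry : length S ≤ maxEntry S
  length≤maxEntry with length S in ℓ≡
  ... | zero  = z≤n
  ... | suc ℓ = ≤-trans (index≤head (s≤s z≤n) ℓ≤) (≤maxEntry (head-∈ (s≤s z≤n) ℓ≤))
    where ℓ≤ = ≤-reflexive (sym ℓ≡)

-- The vector Δ

Δentry : ℕ → ℕ → ℕ → ℤ
Δentry g s i = (+ g) ℤ.+ (+ s) ℤ.- (+ i)

Δentry-suc-row : ∀ g s i → Δentry (suc g) s i ≡ Δentry g (suc s) i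
Δentry-suc-row g s i = cong (λ n → + n ℤ.- + i) (sym (+-suc g s))

Δentry-suc-suc : ∀ g s i → Δentry g (suc s) (suc i) ≡ Δentry g s i
Δentry-suc-suc g s i = begin
  + (g + suc s) ℤ.- + suc i ≡⟨ ℤₚ.[+m]-[+n]≡m⊖n (g + suc s) (suc i) ⟩
  (g + suc s) ⊖ suc i       ≡⟨ cong (_⊖ suc i) (+-suc g s) ⟩
  suc (g + s) ⊖ suc i       ≡⟨ ℤₚ.[1+m]⊖[1+n]≡m⊖n (g + s) i ⟩
  (g + s) ⊖ i               ≡⟨ ℤₚ.[+m]-[+n]≡m⊖n (g + s) i ⟨
  + (g + s) ℤ.- + i         ∎
  where open ≡-Reasoning

Δentry-diag : ∀ g s → Δentry g s (g + s) ≡ + 0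
Δentry-diag g s = trans (ℤₚ.[+m]-[+n]≡m⊖n (g + s) (g + s)) (ℤₚ.n⊖n≡0 (g + s))

Δentry-nonneg : ∀ g s {i m} → Δentry g s i ≡ + m → i ≤ g + s
Δentry-nonneg g s {i} eq with i ≤? g + s
... | yes i≤ = i≤
... | no  i≰ with () ← trans (cong ℤ.sign (trans (sym eq) (ℤₚ.[+m]-[+n]≡m⊖n (g + s) i)))
                              (ℤₚ.sign-⊖-≰ i≰)

length-deltaFrom : ∀ a γ σ → length γ ≡ length σ → length (deltaFrom a γ σ) ≡ length γ
length-deltaFrom a []      []      _   = refl
length-deltaFrom a (g ∷ γ) (s ∷ σ) len = cong suc (length-deltaFrom (suc a) γ σ (suc-injective len))

get-deltaFrom : ∀ a γ σ i → suc i ≤ length γ → suc i ≤ length σ →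
                get (+ 0) (deltaFrom a γ σ) (suc i) ≡ Δentry (get 0 γ (suc i)) (get 0 σ (suc i)) (a + i)
get-deltaFrom a (g ∷ γ) (s ∷ σ) zero    _         _         = cong (Δentry g s) (sym (+-identityʳ a))
get-deltaFrom a (g ∷ γ) (s ∷ σ) (suc i) (s≤s i<γ) (s≤s i<σ) =
  trans (get-deltaFrom (suc a) γ σ i i<γ i<σ)
        (cong (Δentry (get 0 γ (suc i)) (get 0 σ (suc i))) (sym (+-suc a i)))

Δ-at : List (List ℕ) → List ℕ → ℕ → ℤ
Δ-at T τ i = Δentry (length (row T i)) (τ ⟨ i ⟩) i

length-Δ-shape : ∀ T τ → length T ≡ length τ → length (Δ (shape T) τ) ≡ length T
length-Δ-shape T τ len =
  trans (length-deltaFrom 1 (shape T) τ (trans (length-map length T) len)) (length-map length T)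

get-Δ-shape : ∀ T τ {i} → 1 ≤ i → i ≤ length T → i ≤ length τ → get (+ 0) (Δ (shape T) τ) i ≡ Δ-at T τ i
get-Δ-shape T τ {suc i} _ i≤T i≤τ =
  trans (get-deltaFrom 1 (shape T) τ i (subst (suc i ≤_) (sym (length-map length T)) i≤T) i≤τ)
        (cong (λ g → Δentry g (get 0 τ (suc i)) (suc i)) (get-map length {[]} T (suc i)))

Δ-shape-ext : ∀ T τ zs → length T ≡ length τ → length zs ≡ length T →
              (∀ i → 1 ≤ i → i ≤ length T → Δ-at T τ i ≡ get (+ 0) zs i) →
              Δ (shape T) τ ≡ zs
Δ-shape-ext T τ zs T≡τ zs≡T pointwise =
  get-extensionality (+ 0) _ zs (trans (length-Δ-shape T τ T≡τ) (sym zs≡T)) λ i 1≤i i≤ →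
    let i≤T = subst (i ≤_) (length-Δ-shape T τ T≡τ) i≤ in
    trans (get-Δ-shape T τ 1≤i i≤T (subst (i ≤_) T≡τ i≤T)) (pointwise i 1≤i i≤T)

-- The steps of ψ

<∸⇒+< : ∀ k {ℓ j} → j < ℓ ∸ k → k + j < ℓ
<∸⇒+< zero            j< = j<
<∸⇒+< (suc k) {suc ℓ} j< = s≤s (<∸⇒+< k j<)

+<⇒<∸ : ∀ k {ℓ j} → k + j < ℓ → j < ℓ ∸ k
+<⇒<∸ zero            k+j<       = k+j<
+<⇒<∸ (suc k) {suc ℓ} (s≤s k+j<) = +<⇒<∸ k k+j<

∈-between⁻ : ∀ {k ℓ x} → x ∈ between k ℓ → k < x × x ≤ ℓ
∈-between⁻ {k} x∈ with ∈.∈-map⁻ (λ j → suc (k + j)) x∈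
... | j , j∈ , refl = s≤s (m≤m+n k j) , <∸⇒+< k (∈.∈-upTo⁻ j∈)

∈-between⁺ : ∀ {k ℓ x} → k < x → x ≤ ℓ → x ∈ between k ℓ
∈-between⁺ {k} {ℓ} {suc x} (s≤s k≤x) x<ℓ = subst (λ y → suc y ∈ between k ℓ) k+[x∸k]≡x
  (∈.∈-map⁺ (λ j → suc (k + j)) (∈.∈-upTo⁺ (+<⇒<∸ k (subst (_< ℓ) (sym k+[x∸k]≡x) x<ℓ))))
  where k+[x∸k]≡x = m+[n∸m]≡n k≤x

module Choices (σ : List ℕ) (S : List (List ℕ)) where

  ℓ : ℕ
  ℓ = length S

  val : ℕ → ℕ
  val i = (maxEntry S ∸ ℓ) + i

  GoodIndex : ℕ → Set
  GoodIndex i = σ ⟨ i ⟩ ≡ i × All (_≡ val i) (row S i) × (∀ j → 1 ≤ j → j ≤ ℓ → j ≢ i → val i ∉ row S j)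

  goodIndex⁻ : ∀ i → T (goodIndex σ S i) → GoodIndex i
  goodIndex⁻ i t =
    let t₁ , t₂₃ = Equivalence.to T-∧ t
        t₂ , t₃  = Equivalence.to T-∧ t₂₃
    in ==⇒≡ t₁ , All.map ==⇒≡ (all⁺ _ (row S i) t₂) , λ j 1≤j j≤ℓ j≢i v∈ →
         case Equivalence.to T-∨ (All.lookup (all⁺ _ (oneTo ℓ) t₃) (∈-oneTo⁺ ℓ 1≤j j≤ℓ)) of λ where
           (inj₁ j≡i) → j≢i (==⇒≡ j≡i)
           (inj₂ v∉)  → T-not⇒¬T v∉ (mem⁺ v∈)

  goodIndex⁺ : ∀ i → GoodIndex i → T (goodIndex σ S i)
  goodIndex⁺ i (σi≡i , row≡ , elsewhere) =
    Equivalence.from T-∧ (≡⇒== σi≡i , Equivalence.from T-∧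
      (all⁻ _ (All.map ≡⇒== row≡) , all⁻ _ (All.tabulate λ j∈ → Equivalence.from T-∨ (only _ (∈-oneTo⁻ ℓ j∈)))))
    where
    only : ∀ j → 1 ≤ j × j ≤ ℓ → T (j == i) ⊎ T (not (mem (val i) (row S j)))
    only j (1≤j , j≤ℓ) with T? (j == i)
    ... | yes j≡i = inj₁ j≡i
    ... | no  j≢i = inj₂ (¬T⇒T-not (elsewhere j 1≤j j≤ℓ (j≢i ∘ ≡⇒==) ∘ mem⁻ (row S j)))

  goodK⁻ : ∀ {k} → T (goodK σ S k) → ∀ {i} → k < i → i ≤ ℓ → T (goodIndex σ S i)
  goodK⁻ {k} t k<i i≤ℓ = All.lookup (all⁺ _ (between k ℓ) t) (∈-between⁺ k<i i≤ℓ)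

  goodK⁺ : ∀ {k} → (∀ {i} → k < i → i ≤ ℓ → T (goodIndex σ S i)) → T (goodK σ S k)
  goodK⁺ good = all⁻ _ (All.tabulate λ i∈ → let k<i , i≤ℓ = ∈-between⁻ i∈ in good k<i i≤ℓ)

  IsLeastGood : ℕ → Set
  IsLeastGood k = k ≤ ℓ × T (goodK σ S k) × (∀ {j} → j < k → ¬ T (goodK σ S j))

  firstGood-least : ∀ f n a → (∀ j → f j ≡ a + j) → a + n ≡ ℓ → (∀ {j} → j < a → ¬ T (goodK σ S j)) →
                    IsLeastGood (firstGood σ S (applyUpTo f n))
  firstGood-least f zero a f≡ a+0≡ℓ none-before with refl ← trans (sym (+-identityʳ a)) a+0≡ℓ =
    ≤-refl , goodK⁺ (λ ℓ<i i≤ℓ → contradiction i≤ℓ (<⇒≱ ℓ<i)) , none-before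
  firstGood-least f (suc n) a f≡ a+n≡ℓ none-before with T? (goodK σ S (f 0))
  ... | yes good = subst IsLeastGood (sym (if-T good)) (subst IsLeastGood (sym f0≡a)
                     (subst (a ≤_) a+n≡ℓ (m≤m+n a (suc n)) , subst (T ∘ goodK σ S) f0≡a good , none-before))
    where f0≡a = trans (f≡ 0) (+-identityʳ a)
  ... | no  bad  = subst IsLeastGood (sym (if-¬T bad))
                     (firstGood-least (f ∘ suc) n (suc a) (λ j → trans (f≡ (suc j)) (+-suc a j))
                                      (trans (sym (+-suc a n)) a+n≡ℓ) none-up-to-a)
    where
    none-up-to-a : ∀ {j} → j < suc a → ¬ T (goodK σ S j)
    none-up-to-a (s≤s j≤a) with m≤n⇒m<n∨m≡n j≤a
    ... | inj₁ j<a  = none-before j<a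
    ... | inj₂ refl = subst (¬_ ∘ T ∘ goodK σ S) (trans (f≡ 0) (+-identityʳ a)) bad

  kOf-least : IsLeastGood (kOf σ S)
  kOf-least = firstGood-least (λ j → j) ℓ 0 (λ _ → refl) refl (λ ())

  IsArgminσ : List ℕ → ℕ → Set
  IsArgminσ js r = argminσ σ S js ≡ just r × r ∈ js × (∀ {i} → i ∈ js → σ ⟨ r ⟩ ≤ σ ⟨ i ⟩)

  argminσ-spec : ∀ j js → ∃[ r ] IsArgminσ (j ∷ js) r
  argminσ-spec j [] = j , refl , here refl , λ { (here refl) → ≤-refl }
  argminσ-spec j (j′ ∷ js) with argminσ σ S (j′ ∷ js) | argminσ-spec j′ js
  ... | _ | r , refl , r∈ , r-min with T? (σ ⟨ j ⟩ ≤ᵇ σ ⟨ r ⟩)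
  ...   | yes j≤r = j , if-T j≤r , here refl , λ where
                      (here refl) → ≤-refl
                      (there i∈)  → ≤-trans (≤ᵇ⇒≤ (σ ⟨ j ⟩) (σ ⟨ r ⟩) j≤r) (r-min i∈)
  ...   | no  j≰r = r , if-¬T j≰r , there r∈ , λ where
                      (here refl) → <⇒≤ (≰⇒> (j≰r ∘ ≤⇒≤ᵇ))
                      (there i∈)  → r-min i∈

  argminσ-complete : ∀ {j js} → j ∈ js → ∃[ r ] IsArgminσ js r
  argminσ-complete {js = j ∷ js} _ = argminσ-spec j js

module MemberOfC {α β : List ℕ} (β-positive : All (1 ≤_) β) {σ S}
                 (imm : Immaculate S) (perm : IsPerm σ (length S))
                 (thc : thcContent (shape S) σ ≡ map +_ α) (content : HasContent S β) where
  open ImmaculateTableau imm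

  maxEntry≤length : maxEntry S ≤ length β
  maxEntry≤length = foldr-⊔-lub (concat S) (All.tabulate bounded)
    where
    bounded : ∀ {x} → x ∈ concat S → x ≤ length β
    bounded {x} x∈ with x ≤? length β
    ... | yes x≤ = x≤
    ... | no  x≰ = contradiction count≡0 (≢-sym (<⇒≢ (∈⇒1≤count S x∈)))
      where
      count≡0 : count x S ≡ 0
      count≡0 = trans (content x (row-positive (proj₂ (∈-concat⇒∈-row x∈)))) (get-beyond 0 β (≰⇒> x≰))

  every-value-occurs : ∀ {v} → 1 ≤ v → v ≤ maxEntry S → ∃[ j ] v ∈ row S j
  every-value-occurs {v} 1≤v v≤M = ∈-concat⇒∈-row (1≤count⇒∈ S (subst (1 ≤_) (sym (content v 1≤v)) 1≤βv))
    where 1≤βv = All.lookup β-positive (get-∈ 0 β 1≤v (≤-trans v≤M maxEntry≤length))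

  ΔS : List ℤ
  ΔS = Δ (shape S) σ

  length-Δ : length ΔS ≡ length S
  length-Δ = length-Δ-shape S σ (sym (Permutation.length≡ perm))

  get-Δ : ∀ {i} → 1 ≤ i → i ≤ length S → get (+ 0) ΔS i ≡ Δ-at S σ i
  get-Δ 1≤i i≤ℓ = get-Δ-shape S σ 1≤i i≤ℓ (subst (_ ≤_) (sym (Permutation.length≡ perm)) i≤ℓ)

  Δ-nonneg : ∀ {i} → 1 ≤ i → i ≤ length S → i ≤ length (row S i) + σ ⟨ i ⟩
  Δ-nonneg {i} 1≤i i≤ℓ with get (+ 0) ΔS i ℤ.≟ + 0
  ... | yes ≡0 = Δentry-nonneg _ (σ ⟨ i ⟩) (trans (sym (get-Δ 1≤i i≤ℓ)) ≡0)
  ... | no  ≢0 with ∈.∈-map⁻ +_ (subst (_ ∈_) thc (∈.∈-filter⁺ (λ z → ¬? (z ℤ.≟ + 0)) z∈ ≢0))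
    where z∈ = get-∈ (+ 0) ΔS 1≤i (subst (i ≤_) (sym length-Δ) i≤ℓ)
  ...   | a , _ , ≡a = Δentry-nonneg _ (σ ⟨ i ⟩) (trans (sym (get-Δ 1≤i i≤ℓ)) ≡a)

ψ∈C : List ℕ → List ℕ → List ℕ → List (List ℕ) → Set
ψ∈C α β σ S = Σ (List ℕ × List (List ℕ)) (λ res → ψ σ S ≡ just res × InC α β res)

module PositiveK {α β : List ℕ} (β-positive : All (1 ≤_) β) {σ S}
                 (imm : Immaculate S) (perm : IsPerm σ (length S))
                 (thc : thcContent (shape S) σ ≡ map +_ α) (content : HasContent S β)
                 {k′ : ℕ} (kOf≡ : kOf σ S ≡ suc k′) where
  open Choices σ S
  open ImmaculateTableau imm
  open MemberOfC β-positive imm perm thc content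
  open Permutation perm

  k : ℕ
  k = suc k′

  v : ℕ
  v = val k

  k-least : IsLeastGood k
  k-least = subst IsLeastGood kOf≡ kOf-least

  k≤ℓ : k ≤ ℓ
  k≤ℓ = proj₁ k-least

  good-above-k : ∀ {i} → k < i → i ≤ ℓ → GoodIndex i
  good-above-k k<i i≤ℓ = goodIndex⁻ _ (goodK⁻ (proj₁ (proj₂ k-least)) k<i i≤ℓ)

  k-not-good : ¬ GoodIndex k
  k-not-good good = proj₂ (proj₂ k-least) ≤-refl (goodK⁺ λ k′<i i≤ℓ → case m≤n⇒m<n∨m≡n k′<i of λ where
    (inj₁ k<i)  → goodK⁻ (proj₁ (proj₂ k-least)) k<i i≤ℓ
    (inj₂ refl) → goodIndex⁺ k good)

  val-ℓ : val ℓ ≡ maxEntry S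
  val-ℓ = m∸n+n≡m length≤maxEntry

  1≤v : 1 ≤ v
  1≤v = ≤-trans (s≤s z≤n) (m≤n+m k _)

  v≤M : v ≤ maxEntry S
  v≤M = subst (v ≤_) val-ℓ (+-monoʳ-≤ _ k≤ℓ)

  large-value-index : ∀ {x} → v < x → x ≤ maxEntry S → ∃[ i ] k < i × i ≤ ℓ × val i ≡ x
  large-value-index {x} v<x x≤M = x ∸ c , k<i , i≤ℓ , vi≡x
    where
    c = maxEntry S ∸ ℓ
    vi≡x : val (x ∸ c) ≡ x
    vi≡x = m+[n∸m]≡n (≤-trans (m≤m+n c k) (<⇒≤ v<x))
    k<i : k < x ∸ c
    k<i = +-cancelˡ-< c k _ (subst (v <_) (sym vi≡x) v<x)
    i≤ℓ : x ∸ c ≤ ℓ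
    i≤ℓ = +-cancelˡ-≤ c _ ℓ (subst₂ _≤_ (sym vi≡x) (sym val-ℓ) x≤M)

  entries≤v : ∀ {j x} → j ≤ k → x ∈ row S j → x ≤ v
  entries≤v {j} {x} j≤k x∈ with x ≤? v
  ... | yes x≤v = x≤v
  ... | no  x≰v with large-value-index (≰⇒> x≰v) (≤maxEntry x∈)
  ...   | i , k<i , i≤ℓ , refl =
    let 1≤j , j≤ℓ = ∈-row⇒index x∈ in
    contradiction x∈ (proj₂ (proj₂ (good-above-k k<i i≤ℓ)) j 1≤j j≤ℓ (<⇒≢ (≤-<-trans j≤k k<i)))

  v∈row⇒≤k : ∀ {j} → v ∈ row S j → j ≤ k
  v∈row⇒≤k {j} v∈ with j ≤? k
  ... | yes j≤k = j≤k
  ... | no  j≰k = contradiction (+-cancelˡ-≡ _ k j (All.lookup row-j≡ v∈)) (<⇒≢ (≰⇒> j≰k))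
    where row-j≡ = proj₁ (proj₂ (good-above-k (≰⇒> j≰k) (proj₂ (∈-row⇒index v∈))))

  σ-maps-≤k : ∀ {j} → 1 ≤ j → j ≤ k → σ ⟨ j ⟩ ≤ k
  σ-maps-≤k {j} 1≤j j≤k with σ ⟨ j ⟩ ≤? k
  ... | yes σj≤k = σj≤k
  ... | no  σj≰k =
    let 1≤σj , σj≤ℓ = get-range 1≤j (≤-trans j≤k k≤ℓ) in
    contradiction (injective 1≤σj σj≤ℓ 1≤j (≤-trans j≤k k≤ℓ) (proj₁ (good-above-k (≰⇒> σj≰k) σj≤ℓ)))
                  (<⇒≢ (≤-<-trans j≤k (≰⇒> σj≰k)) ∘ sym)

  contains-v : ℕ → Bool
  contains-v j = mem v (row S j)

  candidates : List ℕ
  candidates = filterᵇ contains-v (oneTo ℓ)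

  ∈-candidates⁺ : ∀ {j} → v ∈ row S j → j ∈ candidates
  ∈-candidates⁺ v∈ =
    let 1≤j , j≤ℓ = ∈-row⇒index v∈ in ∈.∈-filter⁺ (T? ∘ contains-v) (∈-oneTo⁺ ℓ 1≤j j≤ℓ) (mem⁺ v∈)

  ∈-candidates⁻ : ∀ {j} → j ∈ candidates → v ∈ row S j
  ∈-candidates⁻ {j} j∈ = mem⁻ (row S j) (proj₂ (∈.∈-filter⁻ (T? ∘ contains-v) {xs = oneTo ℓ} j∈))

  -- Kept opaque: letting Agda unfold r through argminσ makes type checking blow up.
  opaque
    argmin : ∃[ r ] IsArgminσ candidates r
    argmin = argminσ-complete (∈-candidates⁺ (proj₂ (every-value-occurs 1≤v v≤M)))

  r : ℕ
  r = proj₁ argmin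

  v∈row-r : v ∈ row S r
  v∈row-r = ∈-candidates⁻ (proj₁ (proj₂ (proj₂ argmin)))

  r-minimal : ∀ {j} → v ∈ row S j → σ ⟨ r ⟩ ≤ σ ⟨ j ⟩
  r-minimal = proj₂ (proj₂ (proj₂ argmin)) ∘ ∈-candidates⁺

  1≤r : 1 ≤ r
  1≤r = proj₁ (∈-row⇒index v∈row-r)

  r≤ℓ : r ≤ ℓ
  r≤ℓ = proj₂ (∈-row⇒index v∈row-r)

  r≤k : r ≤ k
  r≤k = v∈row⇒≤k v∈row-r

  q : ℕ
  q = σ ⟨ r ⟩

  1≤q : 1 ≤ q
  1≤q = proj₁ (get-range 1≤r r≤ℓ)

  q≤k : q ≤ k
  q≤k = σ-maps-≤k 1≤r r≤k

  σ≡q⇒r : ∀ {j} → 1 ≤ j → j ≤ ℓ → σ ⟨ j ⟩ ≡ q → j ≡ r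
  σ≡q⇒r 1≤j j≤ℓ = injective 1≤j j≤ℓ 1≤r r≤ℓ

  opaque
    row-r-∷ʳ : ∃[ row′ ] row S r ≡ row′ ∷ʳ v
    row-r-∷ʳ with nonempty⇒∷ʳ (row-nonempty 1≤r r≤ℓ)
    ... | row′ , z , row-r≡ = row′ , trans row-r≡ (cong (row′ ∷ʳ_) (≤-antisym z≤v v≤z))
      where
      z∈ : z ∈ row S r
      z∈ = subst (z ∈_) (sym row-r≡) (∈.∈-++⁺ʳ row′ (here refl))
      z≤v : z ≤ v
      z≤v = entries≤v r≤k z∈
      v≤z : v ≤ z
      v≤z = All.lookup (Linked-∷ʳ⇒All ≤-trans ≤-refl row′ (subst (Linked _≤_) row-r≡ (row-sorted 1≤r r≤ℓ)))
                       (subst (v ∈_) row-r≡ v∈row-r)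

  row′ : List ℕ
  row′ = proj₁ row-r-∷ʳ

  row-r≡ : row S r ≡ row′ ∷ʳ v
  row-r≡ = proj₂ row-r-∷ʳ

  S₁ : List (List ℕ)
  S₁ = modifyAt r (λ _ → row′) S

  k≤ΔS : k ≤ length ΔS
  k≤ΔS = subst (k ≤_) (sym length-Δ) k≤ℓ

  ψ-unfold : ψ σ S ≡ (if q == k then just (sMul k (σ ∷ʳ suc ℓ) , insertAfter k [ v ] S₁)
                      else (indexOf (suc q) σ >>= λ p →
                            if null row′
                            then (restrictPerm (sMul q σ) >>= λ τ →
                                  just (τ , deleteAt r (modifyAt p (_∷ʳ v) S₁)))
                            else just (sMul q σ , modifyAt p (_∷ʳ v) S₁)))
  ψ-unfold = trans (cong (stepsFrom σ S) kOf≡) (trans (>>=-just _ (proj₁ (proj₂ argmin))) (>>=-just _ dropLast≡))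
    where
    dropLast≡ : dropLast (row S r) ≡ just row′
    dropLast≡ = subst (λ xs → dropLast xs ≡ just row′) (sym row-r≡) (dropLast-∷ʳ row′ v)

  length-S₁ : length S₁ ≡ ℓ
  length-S₁ = length-modifyAt r _ S

  S₁-r : row S₁ r ≡ row′
  S₁-r = get-modifyAt-≡ [] r _ S 1≤r r≤ℓ

  S₁-≢r : ∀ {i} → i ≢ r → row S₁ i ≡ row S i
  S₁-≢r = get-modifyAt-≢ [] r _ S _

  length-row-r : length (row S r) ≡ suc (length row′)
  length-row-r = trans (cong length row-r≡) (length-∷ʳ row′ v)

  concat-S₁ : v ∷ concat S₁ ↭ concat S
  concat-S₁ = concat-modifyAt-↭ r _ S 1≤r r≤ℓ (subst (λ xs → v ∷ row′ ↭ xs) (sym row-r≡) (∷↭∷ʳ v row′))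

  module Row′Nonempty (row′-nonempty : 1 ≤ length row′) where

    S₁-isTableauRow : ∀ {i} → 1 ≤ i → i ≤ ℓ → IsTableauRow (row S₁ i)
    S₁-isTableauRow {i} 1≤i i≤ℓ with i ≟ r
    ... | no  i≢r  = subst IsTableauRow (sym (S₁-≢r i≢r)) (row-isTableauRow 1≤i i≤ℓ)
    ... | yes refl = subst IsTableauRow (sym S₁-r)
      ( row′-nonempty
      , All.tabulate (λ x∈ → row-positive (subst (_ ∈_) (sym row-r≡) (∈.∈-++⁺ˡ x∈)))
      , Linked-∷ʳ⁻ row′ (subst (Linked _≤_) row-r≡ (row-sorted 1≤r r≤ℓ)))

    head-S₁ : ∀ i → headD (row S₁ i) ≡ headD (row S i)
    head-S₁ i with i ≟ r
    ... | no  i≢r  = cong headD (S₁-≢r i≢r)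
    ... | yes refl = trans (cong headD S₁-r) (trans (sym (head-∷ʳ row′ v row′-nonempty)) (cong headD (sym row-r≡)))

  ∷ʳv-isTableauRow : ∀ {j} → 1 ≤ j → j ≤ k → IsTableauRow (row S j ∷ʳ v)
  ∷ʳv-isTableauRow {j} 1≤j j≤k =
    subst (1 ≤_) (sym (length-∷ʳ (row S j) v)) (s≤s z≤n) ,
    All.tabulate (λ x∈ → case ∈.∈-++⁻ (row S j) x∈ of λ where
      (inj₁ x∈row)      → row-positive x∈row
      (inj₂ (here refl)) → 1≤v) ,
    Linked-∷ʳ⁺ (row-sorted 1≤j (≤-trans j≤k k≤ℓ)) (All.tabulate (entries≤v j≤k))

  head-r≡v⇒r≡k : headD (row S r) ≡ v → r ≡ k
  head-r≡v⇒r≡k head≡v with m≤n⇒m<n∨m≡n r≤k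
  ... | inj₂ r≡k = r≡k
  ... | inj₁ r<k = contradiction (head-< 1≤r r<k k≤ℓ) (≤⇒≯ (subst (headD (row S k) ≤_) (sym head≡v) head-k≤v))
    where head-k≤v = entries≤v ≤-refl (head-∈ (s≤s z≤n) k≤ℓ)

  module Step4 (q≡k : q ≡ k) where

    head-k<v : headD (row S k) < v
    head-k<v with m≤n⇒m<n∨m≡n (entries≤v ≤-refl (head-∈ (s≤s z≤n) k≤ℓ))
    ... | inj₁ head<v = head<v
    ... | inj₂ head≡v = contradiction (σ-k , row-k≡v , only-k) k-not-good
      where
      σ≡k : ∀ {j} → v ∈ row S j → σ ⟨ j ⟩ ≡ k
      σ≡k v∈ = ≤-antisym (σ-maps-≤k (proj₁ (∈-row⇒index v∈)) (v∈row⇒≤k v∈)) (subst (_≤ _) q≡k (r-minimal v∈))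
      σ-k : σ ⟨ k ⟩ ≡ k
      σ-k = σ≡k (subst (_∈ row S k) head≡v (head-∈ (s≤s z≤n) k≤ℓ))
      row-k≡v : All (_≡ v) (row S k)
      row-k≡v = All.tabulate λ x∈ →
        ≤-antisym (entries≤v ≤-refl x∈) (subst (_≤ _) head≡v (head-≤ (s≤s z≤n) k≤ℓ x∈))
      only-k : ∀ j → 1 ≤ j → j ≤ ℓ → j ≢ k → v ∉ row S j
      only-k j 1≤j j≤ℓ j≢k v∈ = j≢k (injective 1≤j j≤ℓ (s≤s z≤n) k≤ℓ (trans (σ≡k v∈) (sym σ-k)))

    row′-nonempty : 1 ≤ length row′
    row′-nonempty with row′ | row-r≡
    ... | _ ∷ _ | _         = s≤s z≤n
    ... | []    | row-r≡[v] =
      contradiction (subst (λ i → headD (row S i) ≡ v) (head-r≡v⇒r≡k head-r≡v) head-r≡v) (<⇒≢ head-k<v)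
      where head-r≡v = cong headD row-r≡[v]

    open Row′Nonempty row′-nonempty

    U : List (List ℕ)
    U = insertAfter k [ v ] S₁

    σ′ : List ℕ
    σ′ = σ ∷ʳ suc ℓ

    τ : List ℕ
    τ = sMul k σ′

    k≤S₁ : k ≤ length S₁
    k≤S₁ = subst (k ≤_) (sym length-S₁) k≤ℓ

    length-U : length U ≡ suc ℓ
    length-U = trans (length-insertAfter k [ v ] S₁ k≤S₁) (cong suc length-S₁)

    U-below : ∀ {i} → i ≤ k → row U i ≡ row S₁ i
    U-below = get-insertAfter-≤ [] k [ v ] S₁ k≤S₁

    U-at : row U (suc k) ≡ [ v ]
    U-at = get-insertAfter-suc [] k [ v ] S₁ k≤S₁

    U-above : ∀ {i} → k < i → row U (suc i) ≡ row S i
    U-above k<i = trans (get-insertAfter-> [] k [ v ] S₁ k<i) (S₁-≢r (<⇒≢ (≤-<-trans r≤k k<i) ∘ sym))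

    U-rows : ∀ i → 1 ≤ i → i ≤ length U → IsTableauRow (row U i)
    U-rows i 1≤i i≤U with position k i
    ... | below i≤k = subst IsTableauRow (sym (U-below i≤k)) (S₁-isTableauRow 1≤i (≤-trans i≤k k≤ℓ))
    ... | at        = subst IsTableauRow (sym U-at) (s≤s z≤n , 1≤v ∷ [] , [-])
    ... | above k<i = subst IsTableauRow (sym (U-above k<i))
                            (row-isTableauRow (≤-trans (s≤s z≤n) k<i) (≤-pred (subst (_ ≤_) length-U i≤U)))

    head-U-below : ∀ {i} → i ≤ k → headD (row U i) ≡ headD (row S i)
    head-U-below {i} i≤k = trans (cong headD (U-below i≤k)) (head-S₁ i)

    v<head-suc-k : suc k ≤ ℓ → v < headD (row S (suc k))
    v<head-suc-k sk≤ℓ = subst (v <_) (sym (trans head≡ (+-suc _ k))) ≤-refl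
      where head≡ = All.lookup (proj₁ (proj₂ (good-above-k ≤-refl sk≤ℓ))) (head-∈ (s≤s z≤n) sk≤ℓ)

    U-heads : ∀ i → 1 ≤ i → suc i ≤ length U → headD (row U i) < headD (row U (suc i))
    U-heads i 1≤i si≤U with position k i
    U-heads i 1≤i si≤U | below i≤k with m≤n⇒m<n∨m≡n i≤k
    ... | inj₁ i<k  = subst₂ _<_ (sym (head-U-below i≤k)) (sym (head-U-below i<k))
                                 (head-< 1≤i ≤-refl (≤-trans i<k k≤ℓ))
    ... | inj₂ refl = subst₂ _<_ (sym (head-U-below ≤-refl)) (sym (cong headD U-at)) head-k<v
    U-heads _ _ si≤U | at = subst₂ _<_ (sym (cong headD U-at)) (sym (cong headD (U-above ≤-refl)))
                                   (v<head-suc-k (≤-pred (subst (_ ≤_) length-U si≤U)))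
    U-heads _ _ si≤U | above {i} k<i =
      subst₂ _<_ (sym (cong headD (U-above k<i))) (sym (cong headD (U-above (m<n⇒m<1+n k<i))))
                 (head-< (≤-trans (s≤s z≤n) k<i) ≤-refl (≤-pred (subst (_ ≤_) length-U si≤U)))

    τ-perm : IsPerm τ (length U)
    τ-perm = subst (IsPerm τ) (sym length-U) (sMul-↭ k (s≤s z≤n) (s≤s k≤ℓ) (∷ʳ-↭-oneTo perm))

    U-content : HasContent U β
    U-content = HasContent-resp-↭ S U β (↭-sym (↭-trans (concat-insertAfter-↭ k [ v ] S₁) concat-S₁)) content

    τ-get : ∀ i → τ ⟨ i ⟩ ≡ transpose k (σ′ ⟨ i ⟩)
    τ-get i = get-sMul k σ′ i (s≤s z≤n)

    σ′-≤ℓ : ∀ {i} → i ≤ ℓ → σ′ ⟨ i ⟩ ≡ σ ⟨ i ⟩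
    σ′-≤ℓ i≤ℓ = get-++ˡ 0 σ [ suc ℓ ] (subst (_ ≤_) (sym length≡) i≤ℓ)

    σ′-fixed : ∀ {i} → k < i → i ≤ suc ℓ → σ′ ⟨ i ⟩ ≡ i
    σ′-fixed {i} k<i i≤sℓ with m≤n⇒m<n∨m≡n i≤sℓ
    ... | inj₁ (s≤s i≤ℓ) = trans (σ′-≤ℓ i≤ℓ) (proj₁ (good-above-k k<i i≤ℓ))
    ... | inj₂ refl      = subst (λ n → σ′ ⟨ suc n ⟩ ≡ suc ℓ) length≡ (get-∷ʳ-last 0 σ (suc ℓ))

    length-τ : length τ ≡ suc ℓ
    length-τ = trans (length-map _ σ′) (trans (length-∷ʳ σ (suc ℓ)) (cong suc length≡))

    Δ-U-below : ∀ {i} → 1 ≤ i → i ≤ k → Δ-at U τ i ≡ Δ-at S σ i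
    Δ-U-below {i} 1≤i i≤k with i ≟ r
    ... | yes refl = begin
      Δ-at U τ r                      ≡⟨ cong₂ (λ g s → Δentry g s r) (cong length (trans (U-below i≤k) S₁-r)) τ-r ⟩
      Δentry (length row′) (suc k) r  ≡⟨ Δentry-suc-row (length row′) k r ⟨
      Δentry (suc (length row′)) k r  ≡⟨ cong₂ (λ g s → Δentry g s r) (sym length-row-r) (sym q≡k) ⟩
      Δ-at S σ r                      ∎
      where
      open ≡-Reasoning
      τ-r : τ ⟨ r ⟩ ≡ suc k
      τ-r = trans (τ-get r) (trans (cong (transpose k) (trans (σ′-≤ℓ r≤ℓ) q≡k)) (transpose-q k))
    ... | no  i≢r = cong₂ (λ g s → Δentry g s i) (cong length (trans (U-below i≤k) (S₁-≢r i≢r))) τ-i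
      where
      i≤ℓ = ≤-trans i≤k k≤ℓ
      σi≢k : σ ⟨ i ⟩ ≢ k
      σi≢k σi≡k = i≢r (σ≡q⇒r 1≤i i≤ℓ (trans σi≡k (sym q≡k)))
      τ-i : τ ⟨ i ⟩ ≡ σ ⟨ i ⟩
      τ-i = trans (τ-get i) (trans (cong (transpose k) (σ′-≤ℓ i≤ℓ))
                                   (transpose-other k σi≢k (<⇒≢ (s≤s (σ-maps-≤k 1≤i i≤k)))))

    Δ-U-at : Δ-at U τ (suc k) ≡ + 0
    Δ-U-at = trans (cong₂ (λ g s → Δentry g s (suc k)) (cong length U-at) τ-suc-k) (Δentry-diag 1 k)
      where
      τ-suc-k : τ ⟨ suc k ⟩ ≡ k
      τ-suc-k = trans (τ-get (suc k)) (trans (cong (transpose k) (σ′-fixed ≤-refl (s≤s k≤ℓ))) (transpose-suc k))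

    Δ-U-above : ∀ {i} → k < i → i ≤ ℓ → Δ-at U τ (suc i) ≡ Δ-at S σ i
    Δ-U-above {i} k<i i≤ℓ = begin
      Δ-at U τ (suc i)                           ≡⟨ cong₂ (λ g s → Δentry g s (suc i)) length-U-suc-i τ-suc-i ⟩
      Δentry (length (row S i)) (suc i) (suc i)  ≡⟨ Δentry-suc-suc (length (row S i)) i i ⟩
      Δentry (length (row S i)) i i              ≡⟨ cong (λ s → Δentry (length (row S i)) s i) σ-i ⟨
      Δ-at S σ i                                 ∎
      where
      open ≡-Reasoning
      σ-i = proj₁ (good-above-k k<i i≤ℓ)
      length-U-suc-i = cong length (U-above k<i)
      τ-suc-i : τ ⟨ suc i ⟩ ≡ suc i
      τ-suc-i = trans (τ-get (suc i)) (trans (cong (transpose k) (σ′-fixed (m<n⇒m<1+n k<i) (s≤s i≤ℓ)))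
                                             (transpose-other k (<⇒≢ (m<n⇒m<1+n k<i) ∘ sym) (<⇒≢ (s≤s k<i) ∘ sym)))

    ΔU≡ : Δ (shape U) τ ≡ insertAfter k (+ 0) ΔS
    ΔU≡ = Δ-shape-ext U τ _ (trans length-U (sym length-τ))
            (trans (length-insertAfter k (+ 0) ΔS k≤ΔS) (trans (cong suc length-Δ) (sym length-U))) pointwise
      where
      pointwise : ∀ i → 1 ≤ i → i ≤ length U → Δ-at U τ i ≡ get (+ 0) (insertAfter k (+ 0) ΔS) i
      pointwise i 1≤i i≤U with position k i
      ... | below i≤k = trans (Δ-U-below 1≤i i≤k)
                              (sym (trans (get-insertAfter-≤ (+ 0) k (+ 0) ΔS k≤ΔS i≤k) (get-Δ 1≤i (≤-trans i≤k k≤ℓ))))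
      ... | at        = trans Δ-U-at (sym (get-insertAfter-suc (+ 0) k (+ 0) ΔS k≤ΔS))
      ... | above k<i = trans (Δ-U-above k<i i≤ℓ)
                              (sym (trans (get-insertAfter-> (+ 0) k (+ 0) ΔS k<i) (get-Δ (≤-trans (s≤s z≤n) k<i) i≤ℓ)))
        where i≤ℓ = ≤-pred (subst (_ ≤_) length-U i≤U)

    lands-in-C : ψ∈C α β σ S
    lands-in-C = (τ , U) , trans ψ-unfold (if-T {b = q == k} (≡⇒== q≡k)) ,
                 Immaculate-by-rows U U-rows U-heads , τ-perm ,
                 trans (cong fl ΔU≡) (trans (fl-insertAfter-0 k ΔS) thc) , U-content

  module Step5 (q≢k : q ≢ k) where

    q<k : q < k
    q<k = ≤∧≢⇒< q≤k q≢k

    opaque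
      suc-q-index : ∃[ p ] indexOf (suc q) σ ≡ just p × 1 ≤ p × p ≤ ℓ × σ ⟨ p ⟩ ≡ suc q
      suc-q-index = indexOf-total (s≤s z≤n) (≤-trans q<k k≤ℓ)

    p : ℕ
    p = proj₁ suc-q-index

    1≤p : 1 ≤ p
    1≤p = proj₁ (proj₂ (proj₂ suc-q-index))

    p≤ℓ : p ≤ ℓ
    p≤ℓ = proj₁ (proj₂ (proj₂ (proj₂ suc-q-index)))

    σ-p : σ ⟨ p ⟩ ≡ suc q
    σ-p = proj₂ (proj₂ (proj₂ (proj₂ suc-q-index)))

    p≤k : p ≤ k
    p≤k with p ≤? k
    ... | yes p≤k = p≤k
    ... | no  p≰k = contradiction (trans (sym σ-p) (proj₁ (good-above-k (≰⇒> p≰k) p≤ℓ)))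
                                  (<⇒≢ (≤-<-trans q<k (≰⇒> p≰k)))

    p≢r : p ≢ r
    p≢r p≡r = 1+n≢n (trans (sym σ-p) (cong (σ ⟨_⟩) p≡r))

    U₀ : List (List ℕ)
    U₀ = modifyAt p (_∷ʳ v) S₁

    p≤S₁ : p ≤ length S₁
    p≤S₁ = subst (p ≤_) (sym length-S₁) p≤ℓ

    length-U₀ : length U₀ ≡ ℓ
    length-U₀ = trans (length-modifyAt p _ S₁) length-S₁

    U₀-p : row U₀ p ≡ row S p ∷ʳ v
    U₀-p = trans (get-modifyAt-≡ [] p _ S₁ 1≤p p≤S₁) (cong (_∷ʳ v) (S₁-≢r p≢r))

    U₀-≢p : ∀ {i} → i ≢ p → row U₀ i ≡ row S₁ i
    U₀-≢p = get-modifyAt-≢ [] p _ S₁ _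

    U₀-r : row U₀ r ≡ row′
    U₀-r = trans (U₀-≢p (p≢r ∘ sym)) S₁-r

    concat-U₀ : concat S ↭ concat U₀
    concat-U₀ = ↭-sym (↭-trans (concat-modifyAt-↭ p _ S₁ 1≤p p≤S₁ (↭-sym (∷↭∷ʳ v _))) concat-S₁)

    U₀-isTableauRow-≢r : ∀ {i} → 1 ≤ i → i ≤ ℓ → i ≢ r → IsTableauRow (row U₀ i)
    U₀-isTableauRow-≢r {i} 1≤i i≤ℓ i≢r with i ≟ p
    ... | yes refl = subst IsTableauRow (sym U₀-p) (∷ʳv-isTableauRow 1≤p p≤k)
    ... | no  i≢p  = subst IsTableauRow (sym (trans (U₀-≢p i≢p) (S₁-≢r i≢r))) (row-isTableauRow 1≤i i≤ℓ)

    head-U₀-≢r : ∀ {i} → i ≢ r → headD (row U₀ i) ≡ headD (row S i)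
    head-U₀-≢r {i} i≢r with i ≟ p
    ... | yes refl = trans (cong headD U₀-p) (head-∷ʳ (row S p) v (row-nonempty 1≤p p≤ℓ))
    ... | no  i≢p  = cong headD (trans (U₀-≢p i≢p) (S₁-≢r i≢r))

    τ′ : List ℕ
    τ′ = sMul q σ

    length-τ′ : length τ′ ≡ ℓ
    length-τ′ = trans (length-map _ σ) length≡

    τ′-perm : τ′ ↭ oneTo ℓ
    τ′-perm = sMul-↭ q 1≤q (≤-trans q<k k≤ℓ) perm

    τ′-r : τ′ ⟨ r ⟩ ≡ suc q
    τ′-r = trans (get-sMul q σ r 1≤q) (transpose-q q)

    τ′-p : τ′ ⟨ p ⟩ ≡ q
    τ′-p = trans (get-sMul q σ p 1≤q) (trans (cong (transpose q) σ-p) (transpose-suc q))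

    τ′-other : ∀ {i} → 1 ≤ i → i ≤ ℓ → i ≢ r → i ≢ p → τ′ ⟨ i ⟩ ≡ σ ⟨ i ⟩
    τ′-other {i} 1≤i i≤ℓ i≢r i≢p = trans (get-sMul q σ i 1≤q)
      (transpose-other q (i≢r ∘ σ≡q⇒r 1≤i i≤ℓ) (i≢p ∘ injective 1≤i i≤ℓ 1≤p p≤ℓ ∘ flip trans (sym σ-p)))

    ψ-unfold-step5 : ψ σ S ≡ (if null row′ then (restrictPerm τ′ >>= λ τ → just (τ , deleteAt r U₀))
                              else just (τ′ , U₀))
    ψ-unfold-step5 =
      trans ψ-unfold (trans (if-¬T {b = q == k} (q≢k ∘ ==⇒≡)) (>>=-just _ (proj₁ (proj₂ suc-q-index))))

    Δ-U₀-≢r : ∀ {i} → 1 ≤ i → i ≤ ℓ → i ≢ r → Δ-at U₀ τ′ i ≡ Δ-at S σ i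
    Δ-U₀-≢r {i} 1≤i i≤ℓ i≢r with i ≟ p
    ... | yes refl = begin
      Δ-at U₀ τ′ p                          ≡⟨ cong₂ (λ g s → Δentry g s p) length-U₀-p τ′-p ⟩
      Δentry (suc (length (row S p))) q p   ≡⟨ Δentry-suc-row (length (row S p)) q p ⟩
      Δentry (length (row S p)) (suc q) p   ≡⟨ cong (λ s → Δentry (length (row S p)) s p) σ-p ⟨
      Δ-at S σ p                            ∎
      where
      open ≡-Reasoning
      length-U₀-p = trans (cong length U₀-p) (length-∷ʳ (row S p) v)
    ... | no  i≢p  =
      cong₂ (λ g s → Δentry g s i) (cong length (trans (U₀-≢p i≢p) (S₁-≢r i≢r))) (τ′-other 1≤i i≤ℓ i≢r i≢p)

    module KeepRow (row′-nonempty : 1 ≤ length row′) where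
      open Row′Nonempty row′-nonempty

      U₀-rows : ∀ i → 1 ≤ i → i ≤ length U₀ → IsTableauRow (row U₀ i)
      U₀-rows i 1≤i i≤U₀ with i ≟ r
      ... | yes refl = subst IsTableauRow (sym (U₀-≢p (p≢r ∘ sym))) (S₁-isTableauRow 1≤r r≤ℓ)
      ... | no  i≢r  = U₀-isTableauRow-≢r 1≤i (subst (i ≤_) length-U₀ i≤U₀) i≢r

      head-U₀ : ∀ i → headD (row U₀ i) ≡ headD (row S i)
      head-U₀ i with i ≟ r
      ... | yes refl = trans (cong headD (U₀-≢p (p≢r ∘ sym))) (head-S₁ r)
      ... | no  i≢r  = head-U₀-≢r i≢r

      U₀-heads : ∀ i → 1 ≤ i → suc i ≤ length U₀ → headD (row U₀ i) < headD (row U₀ (suc i))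
      U₀-heads i 1≤i si≤U₀ = subst₂ _<_ (sym (head-U₀ i)) (sym (head-U₀ (suc i)))
                                        (head-< 1≤i ≤-refl (subst (_ ≤_) length-U₀ si≤U₀))

      Δ-U₀ : ∀ i → 1 ≤ i → i ≤ ℓ → Δ-at U₀ τ′ i ≡ Δ-at S σ i
      Δ-U₀ i 1≤i i≤ℓ with i ≟ r
      ... | no  i≢r  = Δ-U₀-≢r 1≤i i≤ℓ i≢r
      ... | yes refl = begin
        Δ-at U₀ τ′ r                    ≡⟨ cong₂ (λ g s → Δentry g s r) (cong length U₀-r) τ′-r ⟩
        Δentry (length row′) (suc q) r  ≡⟨ Δentry-suc-row (length row′) q r ⟨
        Δentry (suc (length row′)) q r  ≡⟨ cong (λ g → Δentry g q r) length-row-r ⟨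
        Δ-at S σ r                      ∎
        where open ≡-Reasoning

      ΔU₀≡ : Δ (shape U₀) τ′ ≡ ΔS
      ΔU₀≡ = Δ-shape-ext U₀ τ′ _ (trans length-U₀ (sym length-τ′)) (trans length-Δ (sym length-U₀)) λ i 1≤i i≤U₀ →
        let i≤ℓ = subst (i ≤_) length-U₀ i≤U₀ in trans (Δ-U₀ i 1≤i i≤ℓ) (sym (get-Δ 1≤i i≤ℓ))

      lands-in-C : ψ∈C α β σ S
      lands-in-C = (τ′ , U₀) , trans ψ-unfold-step5 (if-¬T (nonempty⇒¬null {xs = row′} row′-nonempty)) ,
                   Immaculate-by-rows U₀ U₀-rows U₀-heads , subst (IsPerm τ′) (sym length-U₀) τ′-perm ,
                   trans (cong fl ΔU₀≡) thc , HasContent-resp-↭ S U₀ β concat-U₀ content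

    module DropRow (row′≡[] : row′ ≡ []) where

      row-r≡[v] : row S r ≡ [ v ]
      row-r≡[v] = trans row-r≡ (cong (_∷ʳ v) row′≡[])

      r≡k : r ≡ k
      r≡k = head-r≡v⇒r≡k (cong headD row-r≡[v])

      suc-q≡k : suc q ≡ k
      suc-q≡k = ≤-antisym q<k (subst₂ _≤_ r≡k (cong (_+ q) (cong length row-r≡[v])) (Δ-nonneg 1≤r r≤ℓ))

      i<k⇒i≢r : ∀ {i} → i < k → i ≢ r
      i<k⇒i≢r i<k i≡r = <⇒≢ i<k (trans i≡r r≡k)

      k<i⇒i≢r : ∀ {i} → k < i → i ≢ r
      k<i⇒i≢r k<i i≡r = <⇒≢ k<i (sym (trans i≡r r≡k))

      k<i⇒i≢p : ∀ {i} → k < i → i ≢ p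
      k<i⇒i≢p k<i = <⇒≢ (≤-<-trans p≤k k<i) ∘ sym

      τ′-fixed : ∀ {i} → k ≤ i → i ≤ ℓ → τ′ ⟨ i ⟩ ≡ i
      τ′-fixed {i} k≤i i≤ℓ with m≤n⇒m<n∨m≡n k≤i
      ... | inj₂ refl = subst (λ j → τ′ ⟨ j ⟩ ≡ j) r≡k (trans τ′-r (trans suc-q≡k (sym r≡k)))
      ... | inj₁ k<i  = trans (τ′-other (≤-trans (s≤s z≤n) k≤i) i≤ℓ (k<i⇒i≢r k<i) (k<i⇒i≢p k<i))
                              (proj₁ (good-above-k k<i i≤ℓ))

      ℓ′ : ℕ
      ℓ′ = ℓ ∸ 1

      suc-ℓ′ : suc ℓ′ ≡ ℓ
      suc-ℓ′ = suc-pred ℓ ⦃ >-nonZero (≤-trans (s≤s z≤n) k≤ℓ) ⦄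

      U : List (List ℕ)
      U = deleteAt k U₀

      τ : List ℕ
      τ = take ℓ′ τ′

      length-U : length U ≡ ℓ′
      length-U = suc-injective (trans (length-deleteAt k U₀ (s≤s z≤n) (subst (k ≤_) (sym length-U₀) k≤ℓ))
                                      (trans length-U₀ (sym suc-ℓ′)))

      suc-≤ℓ : ∀ {i} → i ≤ length U → suc i ≤ ℓ
      suc-≤ℓ {i} i≤U = subst (suc i ≤_) suc-ℓ′ (s≤s (subst (i ≤_) length-U i≤U))

      U-< : ∀ {i} → i < k → row U i ≡ row U₀ i
      U-< = get-deleteAt-< [] k U₀

      U-≥ : ∀ {i} → k ≤ i → row U i ≡ row S (suc i)
      U-≥ {i} k≤i = trans (get-deleteAt-≥ [] k U₀ (s≤s z≤n) k≤i)
                          (trans (U₀-≢p (k<i⇒i≢p (s≤s k≤i))) (S₁-≢r (k<i⇒i≢r (s≤s k≤i))))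

      U-rows : ∀ i → 1 ≤ i → i ≤ length U → IsTableauRow (row U i)
      U-rows i 1≤i i≤U with i <? k
      ... | yes i<k = subst IsTableauRow (sym (U-< i<k))
                            (U₀-isTableauRow-≢r 1≤i (≤-trans (<⇒≤ i<k) k≤ℓ) (i<k⇒i≢r i<k))
      ... | no  i≮k = subst IsTableauRow (sym (U-≥ (≮⇒≥ i≮k))) (row-isTableauRow (s≤s z≤n) (suc-≤ℓ i≤U))

      head-U-< : ∀ {i} → i < k → headD (row U i) ≡ headD (row S i)
      head-U-< i<k = trans (cong headD (U-< i<k)) (head-U₀-≢r (i<k⇒i≢r i<k))

      head-U-≥ : ∀ {i} → k ≤ i → headD (row U i) ≡ headD (row S (suc i))
      head-U-≥ k≤i = cong headD (U-≥ k≤i)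

      U-heads : ∀ i → 1 ≤ i → suc i ≤ length U → headD (row U i) < headD (row U (suc i))
      U-heads i 1≤i si≤U with suc i <? k | i <? k
      ... | yes si<k | _       = subst₂ _<_ (sym (head-U-< (<⇒≤ si<k))) (sym (head-U-< si<k))
                                          (head-< 1≤i ≤-refl (≤-trans (<⇒≤ si<k) k≤ℓ))
      ... | no  si≮k | yes i<k = subst₂ _<_ (sym (head-U-< i<k)) (sym (head-U-≥ (≮⇒≥ si≮k)))
                                          (head-< 1≤i (s≤s (n≤1+n i)) (suc-≤ℓ si≤U))
      ... | no  _    | no  i≮k = subst₂ _<_ (sym (head-U-≥ (≮⇒≥ i≮k))) (sym (head-U-≥ (m≤n⇒m≤1+n (≮⇒≥ i≮k))))
                                          (head-< (s≤s z≤n) ≤-refl (suc-≤ℓ si≤U))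

      τ-perm : IsPerm τ (length U)
      τ-perm = subst (IsPerm τ) (sym length-U)
        (take-↭-oneTo ℓ′ (subst (λ n → τ′ ↭ oneTo n) (sym suc-ℓ′) τ′-perm)
                         (subst (λ n → τ′ ⟨ n ⟩ ≡ n) (sym suc-ℓ′) (τ′-fixed k≤ℓ ≤-refl)))

      U-content : HasContent U β
      U-content = HasContent-resp-↭ S U β (subst (concat S ↭_) (sym concat-U≡) concat-U₀) content
        where concat-U≡ = concat-deleteAt-[] k U₀ (subst (λ j → row U₀ j ≡ []) r≡k (trans U₀-r row′≡[]))

      ΔS-k≡0 : get (+ 0) ΔS k ≡ + 0
      ΔS-k≡0 = begin
        get (+ 0) ΔS k  ≡⟨ get-Δ (s≤s z≤n) k≤ℓ ⟩
        Δ-at S σ k      ≡⟨ cong (Δ-at S σ) r≡k ⟨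
        Δ-at S σ r      ≡⟨ cong₂ (λ g i → Δentry g q i) (cong length row-r≡[v]) (trans r≡k (sym suc-q≡k)) ⟩
        Δentry 1 q (suc q) ≡⟨ Δentry-diag 1 q ⟩
        + 0             ∎
        where open ≡-Reasoning

      length-τ : length τ ≡ ℓ′
      length-τ = trans (length-take ℓ′ τ′) (trans (cong (ℓ′ ⊓_) length-τ′) (m≤n⇒m⊓n≡m (m∸n≤m ℓ 1)))

      length-deleteAt-ΔS : length (deleteAt k ΔS) ≡ length U
      length-deleteAt-ΔS = suc-injective (begin
        suc (length (deleteAt k ΔS)) ≡⟨ length-deleteAt k ΔS (s≤s z≤n) k≤ΔS ⟩
        length ΔS                    ≡⟨ length-Δ ⟩
        ℓ                            ≡⟨ suc-ℓ′ ⟨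
        suc ℓ′                       ≡⟨ cong suc length-U ⟨
        suc (length U)               ∎)
        where open ≡-Reasoning

      Δ-U-< : ∀ {i} → 1 ≤ i → i < k → i ≤ length U → Δ-at U τ i ≡ Δ-at S σ i
      Δ-U-< {i} 1≤i i<k i≤U = begin
        Δ-at U τ i    ≡⟨ cong₂ (λ g s → Δentry g s i) (cong length (U-< i<k)) (get-take 0 ℓ′ τ′ i≤ℓ′) ⟩
        Δ-at U₀ τ′ i  ≡⟨ Δ-U₀-≢r 1≤i (≤-trans (<⇒≤ i<k) k≤ℓ) (i<k⇒i≢r i<k) ⟩
        Δ-at S σ i    ∎
        where
        open ≡-Reasoning
        i≤ℓ′ = subst (i ≤_) length-U i≤U

      Δ-U-≥ : ∀ {i} → k ≤ i → i ≤ length U → Δ-at U τ i ≡ Δ-at S σ (suc i)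
      Δ-U-≥ {i} k≤i i≤U = begin
        Δ-at U τ i                   ≡⟨ cong₂ (λ g s → Δentry g s i) (cong length (U-≥ k≤i)) τ-i ⟩
        Δentry g i i                 ≡⟨ Δentry-suc-suc g i i ⟨
        Δentry g (suc i) (suc i)     ≡⟨ cong (λ s → Δentry g s (suc i)) σ-suc-i ⟨
        Δ-at S σ (suc i)             ∎
        where
        open ≡-Reasoning
        g = length (row S (suc i))
        si≤ℓ = suc-≤ℓ i≤U
        σ-suc-i = proj₁ (good-above-k (s≤s k≤i) si≤ℓ)
        τ-i : τ ⟨ i ⟩ ≡ i
        τ-i = trans (get-take 0 ℓ′ τ′ (subst (i ≤_) length-U i≤U)) (τ′-fixed k≤i (≤-trans (n≤1+n i) si≤ℓ))

      ΔU≡ : Δ (shape U) τ ≡ deleteAt k ΔS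
      ΔU≡ = Δ-shape-ext U τ _ (trans length-U (sym length-τ)) length-deleteAt-ΔS pointwise
        where
        pointwise : ∀ i → 1 ≤ i → i ≤ length U → Δ-at U τ i ≡ get (+ 0) (deleteAt k ΔS) i
        pointwise i 1≤i i≤U with i <? k
        ... | yes i<k = trans (Δ-U-< 1≤i i<k i≤U)
                              (sym (trans (get-deleteAt-< (+ 0) k ΔS i<k) (get-Δ 1≤i (≤-trans (<⇒≤ i<k) k≤ℓ))))
        ... | no  i≮k = trans (Δ-U-≥ k≤i i≤U)
                              (sym (trans (get-deleteAt-≥ (+ 0) k ΔS (s≤s z≤n) k≤i) (get-Δ (s≤s z≤n) (suc-≤ℓ i≤U))))
          where k≤i = ≮⇒≥ i≮k

      ψ≡ : ψ σ S ≡ just (τ , U)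
      ψ≡ = trans ψ-unfold-step5 (trans (if-T (subst (T ∘ null) (sym row′≡[]) _))
             (trans (>>=-just _ (restrictPerm-fixed τ′ length-τ′ (τ′-fixed k≤ℓ ≤-refl)))
                    (cong (λ j → just (τ , deleteAt j U₀)) r≡k)))

      lands-in-C : ψ∈C α β σ S
      lands-in-C = (τ , U) , ψ≡ , Immaculate-by-rows U U-rows U-heads , τ-perm ,
                   trans (cong fl ΔU≡) (trans (fl-deleteAt-0 k ΔS ΔS-k≡0) thc) , U-content

  lands-in-C : ψ∈C α β σ S
  lands-in-C with q ≟ k | []-or-nonempty row′
  ... | yes q≡k | _            = Step4.lands-in-C q≡k
  ... | no  q≢k | inj₁ row′≡[] = Step5.DropRow.lands-in-C q≢k row′≡[]
  ... | no  q≢k | inj₂ 1≤row′  = Step5.KeepRow.lands-in-C q≢k 1≤row′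

lemma4p3 : (n : ℕ) (α β : List ℕ) → IsComposition n α → IsComposition n β →
           (σ : List ℕ) (S : List (List ℕ)) → InC α β (σ , S) →
           Σ (List ℕ × List (List ℕ)) (λ res → ψ σ S ≡ just res × InC α β res)
lemma4p3 n α β _ (β-positive , _) σ S (imm , perm , thc , content) = by-k (kOf σ S) refl
  where
  by-k : ∀ k → kOf σ S ≡ k → ψ∈C α β σ S
  by-k zero     kOf≡ = (σ , S) , cong (stepsFrom σ S) kOf≡ , imm , perm , thc , content
  by-k (suc k′) kOf≡ = PositiveK.lands-in-C β-positive imm perm thc content kOf≡
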